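{- For integers $0\le r\le N$, let $\mathbf Z_{N,r}=\sum_T w(T)$, the sum over all rhombic staircase tableaux $T$ of size $(N,r)$. Then, upon specializing $q=1$ and $u=1$, $$\mathbf Z_{N,r}\big|_{q=u=1}=\binom{N}{r}\prod_{i=r}^{N-1}\bigl(\alpha+\beta+\gamma+\delta+i(\alpha+\gamma)(\beta+\delta)\bigr).$$
   Context: Maximal tiling. For $\tau\in\{0,1,2\}^N$, call $j$ a 1-position if $\tau_j=1$ and a 02-position otherwise; let $r=|\tau|_1$. The rhombic diagram $\Gamma(\tau)$ carries its maximal tiling by squares, short rhombi (horizontal and slanted sides) and tall rhombi (vertical and slanted sides). It consists of columns $C_1,\dots,C_N$ placed from right to left. For a 02-position $j$, $C_j$ consists of squares $s(p,j)$ for each 02-position $p\le j$, with $s(j,j)$ at the bottom (the corner square) and $s(p,j)$ above $s(p',j)$ whenever $p<p'$, and on top one short rhombus for each 1-position $i<j$. For a 1-position $j$, $C_j$ consists of tall rhombi $\rho(p,j)$, one for each 02-position $p<j$. Each 02-column is a vertical strip (ordered bottom to top); for each 02-position $p$, the horizontal strip $H_p$ consists of $s(p,p)$ and, for each $j>p$, the tile $s(p,j)$ or $\rho(p,j)$, ordered from right to left. The size of $\Gamma(\tau)$ is $(N,r)$. A rhombic staircase tableau of shape $\Gamma(\tau)$ is a filling with: squares empty or containing $\alpha,\beta,\gamma$ or $\delta$; tall rhombi empty or containing $\beta u$ or $\delta q$; short rhombi empty or containing $\alpha u$ or $\gamma q$; the lowest square of each vertical strip nonempty; every tile above a tile containing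 $\alpha$ or $\gamma$ (incl. $\alpha u,\gamma q$) in the same vertical strip empty; every tile left of a tile containing $\beta$ or $\delta$ (incl. $\beta u,\delta q$) in the same horizontal strip empty. Its size is that of its shape. Weight: each empty tile is assigned a monomial ("sees to its right" = closest nonempty tile to its right in its horizontal strip; "sees below" = closest nonempty tile below in its vertical strip; $\alpha u,\beta u,\gamma q,\delta q$ count as $\alpha,\beta,\gamma,\delta$): empty square seeing $\beta$ (resp. $\delta$) to the right gets $u$ (resp. $q$); seeing $\alpha/\gamma$ to the right and $\alpha/\delta$ below gets $u$; seeing $\alpha/\gamma$ to the right and $\beta/\gamma$ below gets $q$; empty tall rhombus seeing $\beta$, $\delta$, or $\alpha/\gamma$ to the right gets $u^2$, $q^2$, $uq$ respectively; empty short rhombus seeing $\alpha$, $\gamma$, or $\beta/\delta$ below gets $u^2$, $q^2$, $uq$ respectively. $w(T)$ is the product of all labels and assigned monomials. -}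

module Defs where

open import Level using (Level)
open import Data.Bool using (Bool; true; false; if_then_else_; _∧_; not)
open import Data.Nat using (ℕ; zero; suc) renaming (_+_ to _+ℕ_)
open import Data.Nat using ( _∸_; _≡ᵇ_; _≤ᵇ_; _<ᵇ_)
open import Data.List using (List; []; _∷_; _++_; map; concat; concatMap; filter; reverse; upTo; foldr; length)
open import Data.Maybe using (Maybe; just; nothing)
open import Data.Product using (_×_; _,_)
open import Relation.Nullary.Decidable using (does)
open import Data.Bool.Properties using () renaming (_≟_ to _≟B_)
open import Algebra.Bundles using (CommutativeSemiring)

-- Al shape Γ(τ) depends only on which positions of τ are
-- 1-positions.  We encode it by a list  σ : List Bool  of length N,
-- where the j-th entry (j = 1..N) is  true  iff j is a 1-position.

positions : ℕ → List ℕ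
positions N = map suc (upTo N)

nth : List Bool → ℕ → Bool       -- σ at position j (1-based)
nth []       _             = false
nth (x ∷ xs) zero          = false
nth (x ∷ xs) (suc zero)    = x
nth (x ∷ xs) (suc (suc j)) = nth xs (suc j)

is1 : List Bool → ℕ → Bool
is1 σ j = nth σ j

ones : List Bool → List ℕ
ones σ = filter (λ j → is1 σ j ≟B true) (positions (length σ))

zts : List Bool → List ℕ         -- 02-positions, increasing
zts σ = filter (λ j → is1 σ j ≟B false) (positions (length σ))

data Kind : Set where
  sqK tallK shortK : Kind

-- tile k p j :  square s(p,j)  (k = sqK),  tall rhombus ρ(p,j)  (k = tallK),
-- short rhombus in column j for the 1-position p < j  (k = shortK)
data Tile : Set where
  tile : Kind → ℕ → ℕ → Tile

_==K_ : Kind → Kind → Bool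
sqK    ==K sqK    = true
tallK  ==K tallK  = true
shortK ==K shortK = true
_      ==K _      = false

_==T_ : Tile → Tile → Bool
tile k p j ==T tile k' p' j' = (k ==K k') ∧ ((p ≡ᵇ p') ∧ (j ≡ᵇ j'))

-- labels: empty, α, β, γ, δ  (in a tall rhombus Be/De mean βu/δq,
-- in a short rhombus Al/Ga mean αu/γq)
data Lbl : Set where
  Emp Al Be Ga De : Lbl

allowed : Tile → List Lbl
allowed (tile sqK    _ _) = Emp ∷ Al ∷ Be ∷ Ga ∷ De ∷ []
allowed (tile tallK  _ _) = Emp ∷ Be ∷ De ∷ []
allowed (tile shortK _ _) = Emp ∷ Al ∷ Ga ∷ []

isE : Lbl → Bool
isE Emp = true
isE _ = false

isAC : Lbl → Bool
isAC Al = true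
isAC Ga = true
isAC _ = false

isBD : Lbl → Bool
isBD Be = true
isBD De = true
isBD _ = false

-- vertical strip of the 02-column j, from bottom to top:
-- s(j,j), then s(p,j) for 02-positions p < j with decreasing p,
-- then the short rhombi (one per 1-position i < j, with decreasing i).
vstrip : List Bool → ℕ → List Tile
vstrip σ j =
  map (λ p → tile sqK p j) (reverse (filter (λ p → (p ≤ᵇ j) ≟B true) (zts σ)))
  ++ map (λ i → tile shortK i j) (reverse (filter (λ i → (i <ᵇ j) ≟B true) (ones σ)))

-- horizontal strip H_p, from right to left: s(p,p), then for j > p the
-- tile s(p,j) (j a 02-position) or ρ(p,j) (j a 1-position).
hstrip : List Bool → ℕ → List Tile
hstrip σ p =
  map (λ j → if is1 σ j then tile tallK p j else tile sqK p j)
      (filter (λ j → (p ≤ᵇ j) ≟B true) (positions (length σ)))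

allTiles : List Bool → List Tile
allTiles σ =
  concatMap (vstrip σ) (zts σ)
  ++ concatMap (λ j → map (λ p → tile tallK p j)
                          (filter (λ p → (p <ᵇ j) ≟B true) (zts σ)))
               (ones σ)

Filling : Set
Filling = List (Tile × Lbl)

fillings : List Tile → List Filling
fillings []       = [] ∷ []
fillings (t ∷ ts) = concatMap (λ l → map ((t , l) ∷_) (fillings ts)) (allowed t)

lab : Filling → Tile → Lbl
lab []             t = Emp
lab ((x , l) ∷ xs) t = if x ==T t then l else lab xs t

allB : {X : Set} → (X → Bool) → List X → Bool
allB P []       = true
allB P (x ∷ xs) = P x ∧ allB P xs

closedAfter : (Lbl → Bool) → List Lbl → Bool
closedAfter P []       = true
closedAfter P (x ∷ xs) = if P x then allB isE xs else closedAfter P xs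

valid : List Bool → Filling → Bool
valid σ F =
  allB (λ j → not (isE (lab F (tile sqK j j)))) (zts σ)
  ∧ (allB (λ j → closedAfter isAC (map (lab F) (vstrip σ j))) (zts σ)  -- above α/γ: empty
  ∧  allB (λ p → closedAfter isBD (map (lab F) (hstrip σ p))) (zts σ)) -- left of β/δ: empty

tableaux : List Bool → List Filling
tableaux σ = filter (λ F → valid σ F ≟B true) (fillings (allTiles σ))

-- closest nonempty label strictly before tile t in a strip
seenBefore : Filling → Tile → List Tile → Maybe Lbl → Maybe Lbl
seenBefore F t []       acc = nothing
seenBefore F t (x ∷ xs) acc =
  if x ==T t then acc
  else seenBefore F t xs (if isE (lab F x) then acc else just (lab F x))

seesRight : List Bool → Filling → Tile → Maybe Lbl
seesRight σ F t@(tile _ p _) = seenBefore F t (hstrip σ p) nothing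

seesBelow : List Bool → Filling → Tile → Maybe Lbl
seesBelow σ F t@(tile _ _ j) = seenBefore F t (vstrip σ j) nothing

module _ {c ℓ : Level} (R : CommutativeSemiring c ℓ) where
  open CommutativeSemiring R

  fromℕ : ℕ → Carrier
  fromℕ zero    = 0#
  fromℕ (suc n) = 1# + fromℕ n

  prodL : List Carrier → Carrier
  prodL = foldr _*_ 1#

  sumL : List Carrier → Carrier
  sumL = foldr _+_ 0#

  module Weights (α β γ δ q u : Carrier) where

    -- weight of an empty tile, given what it sees to its right and below
    emptyW : Kind → Maybe Lbl → Maybe Lbl → Carrier
    emptyW sqK    (just Be) _        = u
    emptyW sqK    (just De) _        = q
    emptyW sqK    (just Al) (just Al) = u
    emptyW sqK    (just Al) (just De) = u
    emptyW sqK    (just Ga) (just Al) = u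
    emptyW sqK    (just Ga) (just De) = u
    emptyW sqK    (just Al) (just Be) = q
    emptyW sqK    (just Al) (just Ga) = q
    emptyW sqK    (just Ga) (just Be) = q
    emptyW sqK    (just Ga) (just Ga) = q
    emptyW tallK  (just Be) _        = u * u
    emptyW tallK  (just De) _        = q * q
    emptyW tallK  (just Al) _        = u * q
    emptyW tallK  (just Ga) _        = u * q
    emptyW shortK _        (just Al) = u * u
    emptyW shortK _        (just Ga) = q * q
    emptyW shortK _        (just Be) = u * q
    emptyW shortK _        (just De) = u * q
    emptyW _      _        _        = 1#   -- never occurs in a tableau

    tileW : List Bool → Filling → Tile → Carrier
    tileW σ F t@(tile k p j) with lab F t
    ... | Emp = emptyW k (seesRight σ F t) (seesBelow σ F t)
    ... | Al = labW k α u
      where labW : Kind → Carrier → Carrier → Carrier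
            labW shortK x y = x * y
            labW _      x y = x
    ... | Be = labW k β u
      where labW : Kind → Carrier → Carrier → Carrier
            labW tallK x y = x * y
            labW _     x y = x
    ... | Ga = labW k γ q
      where labW : Kind → Carrier → Carrier → Carrier
            labW shortK x y = x * y
            labW _      x y = x
    ... | De = labW k δ q
      where labW : Kind → Carrier → Carrier → Carrier
            labW tallK x y = x * y
            labW _     x y = x

    weight : List Bool → Filling → Carrier
    weight σ F = prodL (map (tileW σ F) (allTiles σ))

  shapes : ℕ → List (List Bool)
  shapes zero    = [] ∷ []
  shapes (suc n) = concatMap (λ b → map (b ∷_) (shapes n)) (false ∷ true ∷ [])

  Z : (α β γ δ q u : Carrier) → ℕ → ℕ → Carrier
  Z α β γ δ q u N r =
    sumL (map (λ σ → sumL (map (Weights.weight α β γ δ q u σ) (tableaux σ)))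
              (filter (λ σ → (length (ones σ) ≡ᵇ r) ≟B true) (shapes N)))

  prodRange : ℕ → ℕ → (ℕ → Carrier) → Carrier
  prodRange r N f = prodL (map (λ k → f (r +ℕ k)) (upTo (N ∸ r)))

module Submission where

-- Idea.  Refine the sum over the tableaux of shape Γ(σ) by a variable y that
-- marks every row H_p containing no β or δ:  Zy σ y = Σ_T w(T) y^(free rows).
-- Build Γ(σ) column by column, from right to left (σ ↦ σ ++ [ b ]).  The new
-- column meets Γ(σ) only through the free rows: a free row may receive β or δ
-- in its new tile (and become blocked), a blocked row must receive an empty
-- tile.  Summing over the new column gives, with m the number of 1-positions,
--   Zy (σ ++ [1]) y = Zy σ (y + β + δ)                                (tall rhombi)
--   Zy (σ ++ [0]) y = ((α+γ) y + β + δ + m (α+γ)(β+δ)) · Zy σ (y + β + δ)  (new strip).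
-- Hence Zy σ y is an explicit product depending only on the numbers of 1- and
-- 02-positions; at y = 1 each of the (N choose r) shapes of size (N, r)
-- contributes the product of the theorem.

open import Defs
open import Level using (Level)
open import Data.Nat using (ℕ; zero; suc; _≤_; _<_; z≤n; s≤s; _≡ᵇ_; _≤ᵇ_; _<ᵇ_; _∸_) renaming (_+_ to _+ℕ_)
import Data.Nat.Properties as ℕ
open import Data.Nat.Combinatorics using (_C_; nCk+nC[k+1]≡[n+1]C[k+1])
open import Data.Bool using (Bool; true; false; if_then_else_; _∧_; _∨_; not; T)
open import Data.Bool.Properties using (T-≡; ∧-assoc; ∧-zeroʳ; ∧-identityʳ; ∨-identityʳ; ∨-assoc) renaming (_≟_ to _≟B_)
open import Data.List using (List; []; _∷_; _++_; [_]; map; concat; concatMap; filter; reverse; upTo; applyUpTo; length)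
import Data.List.Properties as List
open import Data.List.Relation.Unary.All as All using (All; []; _∷_)
import Data.List.Relation.Unary.All.Properties as AllP
open import Data.List.Relation.Unary.AllPairs as AllPairs using (AllPairs; []; _∷_)
import Data.List.Relation.Unary.AllPairs.Properties as AllPairsP
open import Data.Empty using (⊥-elim)
open import Data.Maybe using (just; nothing)
open import Data.Product using (_×_; _,_; proj₂)
open import Function using (_∘_)
open import Function.Bundles using (module Equivalence)
open import Relation.Nullary using (¬_; does)
open import Relation.Unary using (Decidable)
open import Relation.Binary.PropositionalEquality as ≡ using (_≡_; refl; cong; cong₂)
open import Algebra.Bundles using (CommutativeSemiring)

module _ {A : Set} where

  filter-cong-local : ∀ {P Q : A → Set} (P? : Decidable P) (Q? : Decidable Q) {xs : List A} →
                      All (λ x → does (P? x) ≡ does (Q? x)) xs → filter P? xs ≡ filter Q? xs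
  filter-cong-local P? Q? [] = refl
  filter-cong-local P? Q? {x ∷ xs} (e ∷ es) with does (P? x) | does (Q? x)
  ... | false | false = filter-cong-local P? Q? es
  ... | true  | true  = cong (x ∷_) (filter-cong-local P? Q? es)
  ... | false | true  with () ← e
  ... | true  | false with () ← e

  All-reverse : ∀ {P : A → Set} {xs : List A} → All P xs → All P (reverse xs)
  All-reverse {xs = []} [] = []
  All-reverse {xs = x ∷ xs} (p ∷ ps) =
    ≡.subst (All _) (≡.sym (List.unfold-reverse x xs)) (AllP.++⁺ (All-reverse ps) (p ∷ []))

  AllPairs-reverse : ∀ {R : A → A → Set} → (∀ {x y} → R x y → R y x) →
                     ∀ {xs} → AllPairs R xs → AllPairs R (reverse xs)
  AllPairs-reverse sym {[]} [] = []
  AllPairs-reverse {R} sym {x ∷ xs} (p ∷ ps) =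
    ≡.subst (AllPairs R) (≡.sym (List.unfold-reverse x xs))
      (AllPairsP.++⁺ (AllPairs-reverse sym ps) ([] ∷ []) (All.map (λ r → sym r ∷ []) (All-reverse p)))

  length-snoc : ∀ (xs : List A) x → length (xs ++ [ x ]) ≡ suc (length xs)
  length-snoc xs x = ≡.trans (List.length-++ xs) (ℕ.+-comm (length xs) 1)

T⇒≡ : ∀ {b} → T b → b ≡ true
T⇒≡ = Equivalence.to T-≡

≤ᵇ-true : ∀ {m n} → m ≤ n → (m ≤ᵇ n) ≡ true
≤ᵇ-true m≤n = T⇒≡ (ℕ.≤⇒≤ᵇ m≤n)

<ᵇ-true : ∀ {m n} → m < n → (m <ᵇ n) ≡ true
<ᵇ-true m<n = T⇒≡ (ℕ.<⇒<ᵇ m<n)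

≤ᵇ-false : ∀ {m n} → ¬ m ≤ n → ¬ (m ≤ᵇ n) ≡ true
≤ᵇ-false {m} {n} m≰n e = m≰n (ℕ.≤ᵇ⇒≤ m n (Equivalence.from T-≡ e))

<ᵇ-false : ∀ {m n} → ¬ m < n → ¬ (m <ᵇ n) ≡ true
<ᵇ-false {m} {n} m≮n e = m≮n (ℕ.<ᵇ⇒< m n (Equivalence.from T-≡ e))

≡ᵇ-refl : ∀ n → (n ≡ᵇ n) ≡ true
≡ᵇ-refl n = T⇒≡ (ℕ.≡⇒≡ᵇ n n refl)

≡ᵇ-false : ∀ {m n} → ¬ m ≡ n → (m ≡ᵇ n) ≡ false
≡ᵇ-false {m} {n} m≢n with m ≡ᵇ n in eq
... | false = refl
... | true  = ⊥-elim (m≢n (ℕ.≡ᵇ⇒≡ m n (Equivalence.from T-≡ eq)))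

anyB : (Lbl → Bool) → List Lbl → Bool
anyB P []       = false
anyB P (x ∷ xs) = P x ∨ anyB P xs

allB-∧ : ∀ {A : Set} (P Q : A → Bool) xs → (allB P xs ∧ allB Q xs) ≡ allB (λ x → P x ∧ Q x) xs
allB-∧ P Q []       = refl
allB-∧ P Q (x ∷ xs) with P x | Q x
... | true  | true  = allB-∧ P Q xs
... | true  | false = ∧-zeroʳ (allB P xs)
... | false | _     = refl

allB-snoc : ∀ {A : Set} (P : A → Bool) L x → allB P (L ++ [ x ]) ≡ allB P L ∧ P x
allB-snoc P []      x = ∧-identityʳ (P x)
allB-snoc P (z ∷ L) x rewrite allB-snoc P L x = ≡.sym (∧-assoc (P z) (allB P L) (P x))

anyB-snoc : ∀ P L x → anyB P (L ++ [ x ]) ≡ anyB P L ∨ P x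
anyB-snoc P []      x = ∨-identityʳ (P x)
anyB-snoc P (z ∷ L) x rewrite anyB-snoc P L x = ≡.sym (∨-assoc (P z) (anyB P L) (P x))

closedAfter-snoc : ∀ P L x → closedAfter P (L ++ [ x ]) ≡ closedAfter P L ∧ (not (anyB P L) ∨ isE x)
closedAfter-snoc P []      x with P x
... | true  = refl
... | false = refl
closedAfter-snoc P (z ∷ L) x with P z
... | true  = allB-snoc isE L x
... | false = closedAfter-snoc P L x

closedAfter-single : ∀ P x → closedAfter P [ x ] ≡ true
closedAfter-single P x with P x
... | true  = refl
... | false = refl

InRange : ℕ → ℕ → Set
InRange N j = 0 < j × j ≤ N

positions-snoc : ∀ N → positions (suc N) ≡ positions N ++ [ suc N ]
positions-snoc N = ≡.trans (cong (map suc) (≡.sym (List.upTo-∷ʳ N))) (List.map-++ suc (upTo N) [ N ])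

positions-inRange : ∀ N → All (InRange N) (positions N)
positions-inRange N = ≡.subst (All (InRange N)) (≡.sym (List.map-upTo suc N))
  (AllP.applyUpTo⁺₁ suc N (λ i<N → s≤s z≤n , i<N))

positions-increasing : ∀ N → AllPairs _<_ (positions N)
positions-increasing N = ≡.subst (AllPairs _<_) (≡.sym (List.map-upTo suc N))
  (AllPairsP.applyUpTo⁺₁ suc N (λ i<j _ → s≤s i<j))

ones-inRange : ∀ σ → All (InRange (length σ)) (ones σ)
ones-inRange σ = AllP.filter⁺ _ (positions-inRange (length σ))

zts-inRange : ∀ σ → All (InRange (length σ)) (zts σ)
zts-inRange σ = AllP.filter⁺ _ (positions-inRange (length σ))

ones-distinct : ∀ σ → AllPairs (λ p q → ¬ p ≡ q) (ones σ)
ones-distinct σ = AllPairs.map ℕ.<⇒≢ (AllPairsP.filter⁺ _ (positions-increasing (length σ)))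

zts-distinct : ∀ σ → AllPairs (λ p q → ¬ p ≡ q) (zts σ)
zts-distinct σ = AllPairs.map ℕ.<⇒≢ (AllPairsP.filter⁺ _ (positions-increasing (length σ)))

nth-snoc-old : ∀ σ b j → 0 < j → j ≤ length σ → nth (σ ++ [ b ]) j ≡ nth σ j
nth-snoc-old (x ∷ σ) b (suc zero) _ _ = refl
nth-snoc-old (x ∷ σ) b (suc (suc j)) _ (s≤s j≤) = nth-snoc-old σ b (suc j) (s≤s z≤n) j≤

nth-snoc-new : ∀ σ b → nth (σ ++ [ b ]) (suc (length σ)) ≡ b
nth-snoc-new [] b = refl
nth-snoc-new (x ∷ []) b = refl
nth-snoc-new (x ∷ y ∷ σ) b = nth-snoc-new (y ∷ σ) b

snoc-induction : ∀ {a} (P : List Bool → Set a) → P [] → (∀ σ b → P σ → P (σ ++ [ b ])) → ∀ σ → P σ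
snoc-induction P base step σ = ≡.subst P (List.reverse-involutive σ) (go (reverse σ))
  where
    go : ∀ ρ → P (reverse ρ)
    go [] = base
    go (b ∷ ρ) = ≡.subst P (≡.sym (List.unfold-reverse b ρ)) (step (reverse ρ) b (go ρ))

oneColumn : List Bool → ℕ → List Tile
oneColumn σ j = map (λ p → tile tallK p j) (filter (λ p → (p <ᵇ j) ≟B true) (zts σ))

-- The one-column extension σ⁺ = σ ++ [ b ] of a shape σ of length N:
-- Γ(σ⁺) is Γ(σ) with a new leftmost column at position N+1, a 02-column
-- when b is false and a 1-column when b is true.  Every row H_p (p ≤ N)
-- gains exactly one tile, newTile p, in that column.

module Extend (σ : List Bool) (b : Bool) where

  N : ℕ
  N = length σ

  σ⁺ : List Bool
  σ⁺ = σ ++ [ b ]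

  newTile : ℕ → Tile
  newTile p = if b then tile tallK p (suc N) else tile sqK p (suc N)

  newAs : Bool → List ℕ
  newAs c = filter (λ _ → b ≟B c) [ suc N ]

  is1-old : ∀ {j} → InRange N j → is1 σ⁺ j ≡ is1 σ j
  is1-old (0<j , j≤N) = nth-snoc-old σ b _ 0<j j≤N

  positions⁺ : positions (length σ⁺) ≡ positions N ++ [ suc N ]
  positions⁺ = ≡.trans (cong positions (length-snoc σ b)) (positions-snoc N)

  select : ∀ c → filter (λ j → is1 σ⁺ j ≟B c) (positions (length σ⁺))
                 ≡ filter (λ j → is1 σ j ≟B c) (positions N) ++ newAs c
  select c = ≡.trans (cong (filter _) positions⁺)
    (≡.trans (List.filter-++ _ (positions N) [ suc N ])
      (cong₂ _++_ (filter-cong-local _ _ (All.map (λ r → cong (λ x → does (x ≟B c)) (is1-old r))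
                                                   (positions-inRange N)))
                  new))
    where
      new : filter (λ j → is1 σ⁺ j ≟B c) [ suc N ] ≡ newAs c
      new with is1 σ⁺ (suc N) | nth-snoc-new σ b
      ... | _ | refl with does (b ≟B c)
      ...   | true  = refl
      ...   | false = refl

  ones⁺ : ones σ⁺ ≡ ones σ ++ newAs true
  ones⁺ = select true

  zts⁺ : zts σ⁺ ≡ zts σ ++ newAs false
  zts⁺ = select false

  drop-new : ∀ {P : ℕ → Set} (P? : Decidable P) c xs → ¬ P (suc N) →
             filter P? (xs ++ newAs c) ≡ filter P? xs
  drop-new P? c xs ¬P = ≡.trans (List.filter-++ P? xs (newAs c))
    (≡.trans (cong (filter P? xs ++_) (List.filter-none P? (AllP.filter⁺ (λ _ → b ≟B c) (¬P ∷ []))))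
             (List.++-identityʳ _))

  vstrip-old : ∀ j → j ≤ N → vstrip σ⁺ j ≡ vstrip σ j
  vstrip-old j j≤N = cong₂ (λ xs ys → map (λ p → tile sqK p j) (reverse xs) ++ map (λ i → tile shortK i j) (reverse ys))
    (≡.trans (cong (filter _) zts⁺) (drop-new _ false (zts σ) (≤ᵇ-false (ℕ.<⇒≱ (s≤s j≤N)))))
    (≡.trans (cong (filter _) ones⁺) (drop-new _ true (ones σ) (<ᵇ-false (ℕ.<⇒≯ (s≤s j≤N)))))

  oneColumn-old : ∀ j → j ≤ N → oneColumn σ⁺ j ≡ oneColumn σ j
  oneColumn-old j j≤N = cong (map (λ p → tile tallK p j))
    (≡.trans (cong (filter _) zts⁺) (drop-new _ false (zts σ) (<ᵇ-false (ℕ.<⇒≯ (s≤s j≤N)))))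

  newTile-at : ∀ p → (if is1 σ⁺ (suc N) then tile tallK p (suc N) else tile sqK p (suc N)) ≡ newTile p
  newTile-at p = cong (λ x → if x then tile tallK p (suc N) else tile sqK p (suc N)) (nth-snoc-new σ b)

  hstrip-old : ∀ p → p ≤ N → hstrip σ⁺ p ≡ hstrip σ p ++ [ newTile p ]
  hstrip-old p p≤N =
    ≡.trans (cong (map tileAt ∘ filter right) positions⁺)
    (≡.trans (cong (map tileAt) (List.filter-++ right (positions N) [ suc N ]))
    (≡.trans (List.map-++ tileAt (filter right (positions N)) _)
    (cong₂ _++_
      (List.map-cong-local (All.map (λ r → cong (λ x → if x then _ else _) (is1-old r))
                                    (AllP.filter⁺ right (positions-inRange N))))
      (≡.trans (cong (map tileAt) (List.filter-all right (≤ᵇ-true (ℕ.m≤n⇒m≤1+n p≤N) ∷ [])))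
               (cong [_] (newTile-at p))))))
    where
      tileAt : ℕ → Tile
      tileAt j = if is1 σ⁺ j then tile tallK p j else tile sqK p j
      right = λ j → (p ≤ᵇ j) ≟B true

  hstrip-new : hstrip σ⁺ (suc N) ≡ [ newTile (suc N) ]
  hstrip-new =
    ≡.trans (cong (map tileAt ∘ filter right) positions⁺)
    (≡.trans (cong (map tileAt) (List.filter-++ right (positions N) [ suc N ]))
    (≡.trans (cong (map tileAt) (cong₂ _++_
        (List.filter-none right (All.map (λ r → ≤ᵇ-false (ℕ.<⇒≱ (s≤s (proj₂ r)))) (positions-inRange N)))
        (List.filter-all right (≤ᵇ-true (ℕ.≤-refl {suc N}) ∷ []))))
      (cong [_] (newTile-at (suc N)))))
    where
      tileAt : ℕ → Tile
      tileAt j = if is1 σ⁺ j then tile tallK (suc N) j else tile sqK (suc N) j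
      right = λ j → (suc N ≤ᵇ j) ≟B true

  old02 : List Tile
  old02 = concatMap (vstrip σ) (zts σ)

  old1 : List Tile
  old1 = concatMap (oneColumn σ) (ones σ)

  old02⁺ : concatMap (vstrip σ⁺) (zts σ) ≡ old02
  old02⁺ = cong concat (List.map-cong-local (All.map (λ r → vstrip-old _ (proj₂ r)) (zts-inRange σ)))

  old1⁺ : concatMap (oneColumn σ⁺) (ones σ) ≡ old1
  old1⁺ = cong concat (List.map-cong-local (All.map (λ r → oneColumn-old _ (proj₂ r)) (ones-inRange σ)))

filter-split-length : ∀ {A : Set} (g : A → Bool) xs →
                      length (filter (λ x → g x ≟B true) xs) +ℕ length (filter (λ x → g x ≟B false) xs) ≡ length xs
filter-split-length g []       = refl
filter-split-length g (x ∷ xs) with g x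
... | true  = cong suc (filter-split-length g xs)
... | false = ≡.trans (ℕ.+-suc _ _) (cong suc (filter-split-length g xs))

zts-length : ∀ σ → length (zts σ) ≡ length σ ∸ length (ones σ)
zts-length σ = ≡.trans (≡.sym (ℕ.m+n∸m≡n (length (ones σ)) _))
  (cong (_∸ length (ones σ))
    (≡.trans (filter-split-length (is1 σ) (positions (length σ)))
             (≡.trans (List.length-map suc (upTo (length σ))) (List.length-upTo (length σ)))))

count1 : List Bool → ℕ
count1 []          = 0
count1 (true ∷ σ)  = suc (count1 σ)
count1 (false ∷ σ) = count1 σ

count1-snoc : ∀ σ b → count1 (σ ++ [ b ]) ≡ count1 σ +ℕ count1 [ b ]
count1-snoc []          b = refl
count1-snoc (true ∷ σ)  b = cong suc (count1-snoc σ b)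
count1-snoc (false ∷ σ) b = count1-snoc σ b

ones-count : ∀ σ → length (ones σ) ≡ count1 σ
ones-count = snoc-induction (λ σ → length (ones σ) ≡ count1 σ) refl step
  where
    step : ∀ σ b → length (ones σ) ≡ count1 σ → length (ones (σ ++ [ b ])) ≡ count1 (σ ++ [ b ])
    step σ b ih = ≡.trans (cong length (Extend.ones⁺ σ b))
                 (≡.trans (List.length-++ (ones σ))
                 (≡.trans (cong₂ _+ℕ_ ih (new b)) (≡.sym (count1-snoc σ b))))
      where
        new : ∀ b → length (Extend.newAs σ b true) ≡ count1 [ b ]
        new true  = refl
        new false = refl

length-filter-map : ∀ {A B : Set} {P : B → Set} (P? : Decidable P) (g : A → B) xs →
                    length (filter P? (map g xs)) ≡ length (filter (P? ∘ g) xs)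
length-filter-map P? g []       = refl
length-filter-map P? g (x ∷ xs) with does (P? (g x))
... | true  = cong suc (length-filter-map P? g xs)
... | false = length-filter-map P? g xs

shapes-count : ∀ {c ℓ} (R : CommutativeSemiring c ℓ) N r →
               length (filter (λ σ → (count1 σ ≡ᵇ r) ≟B true) (shapes R N)) ≡ N C r
shapes-count R zero    zero    = refl
shapes-count R zero    (suc r) = refl
shapes-count R (suc n) r = begin
    length (filter (with-ones r) (map (false ∷_) S ++ (map (true ∷_) S ++ [])))
  ≡⟨ cong length (≡.trans (List.filter-++ (with-ones r) (map (false ∷_) S) _)
                          (cong (λ xs → filter (with-ones r) (map (false ∷_) S) ++ filter (with-ones r) xs) (List.++-identityʳ (map (true ∷_) S)))) ⟩
    length (filter (with-ones r) (map (false ∷_) S) ++ filter (with-ones r) (map (true ∷_) S))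
  ≡⟨ List.length-++ (filter (with-ones r) (map (false ∷_) S)) ⟩
    length (filter (with-ones r) (map (false ∷_) S)) +ℕ length (filter (with-ones r) (map (true ∷_) S))
  ≡⟨ cong₂ _+ℕ_ (length-filter-map (with-ones r) (false ∷_) S) (length-filter-map (with-ones r) (true ∷_) S) ⟩
    length (filter (with-ones r) S) +ℕ length (filter (λ σ → (suc (count1 σ) ≡ᵇ r) ≟B true) S)
  ≡⟨ pascal r ⟩
    suc n C r ∎
  where
    open ≡.≡-Reasoning
    S = shapes R n
    with-ones : ∀ r → Decidable (λ σ → (count1 σ ≡ᵇ r) ≡ true)
    with-ones r σ = (count1 σ ≡ᵇ r) ≟B true
    -- Pascal's rule: the shapes starting with a 1 have one more 1-position.
    pascal : ∀ r → length (filter (with-ones r) S) +ℕ length (filter (λ σ → (suc (count1 σ) ≡ᵇ r) ≟B true) S) ≡ suc n C r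
    pascal zero    = cong₂ _+ℕ_ (shapes-count R n zero)
                                (cong length (List.filter-none (λ σ → (suc (count1 σ) ≡ᵇ zero) ≟B true) (All.universal (λ _ ()) S)))
    pascal (suc r) = ≡.trans (cong₂ _+ℕ_ (shapes-count R n (suc r)) (shapes-count R n r))
                             (≡.trans (ℕ.+-comm (n C suc r) (n C r)) (nCk+nC[k+1]≡[n+1]C[k+1] n r))

shapes-length : ∀ {c ℓ} (R : CommutativeSemiring c ℓ) N → All (λ σ → length σ ≡ N) (shapes R N)
shapes-length R zero    = refl ∷ []
shapes-length R (suc n) = AllP.++⁺ (AllP.map⁺ (All.map (cong suc) (shapes-length R n)))
                                   (AllP.++⁺ (AllP.map⁺ (All.map (cong suc) (shapes-length R n))) [])

shapesOfSize : ∀ {c ℓ} (R : CommutativeSemiring c ℓ) → ℕ → ℕ → List (List Bool)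
shapesOfSize R N r = filter (λ σ → (length (ones σ) ≡ᵇ r) ≟B true) (shapes R N)

shapesOfSize-sizes : ∀ {c ℓ} (R : CommutativeSemiring c ℓ) N r →
                     All (λ σ → length (ones σ) ≡ r × length σ ≡ N) (shapesOfSize R N r)
shapesOfSize-sizes R N r = All.zip
  ( All.map (λ e → ℕ.≡ᵇ⇒≡ _ r (Equivalence.from T-≡ e)) (AllP.all-filter (λ σ → (length (ones σ) ≡ᵇ r) ≟B true) (shapes R N))
  , AllP.filter⁺ (λ σ → (length (ones σ) ≡ᵇ r) ≟B true) (shapes-length R N))

shapesOfSize-count : ∀ {c ℓ} (R : CommutativeSemiring c ℓ) N r → length (shapesOfSize R N r) ≡ N C r
shapesOfSize-count R N r = ≡.trans
  (cong length (filter-cong-local _ (λ σ → (count1 σ ≡ᵇ r) ≟B true)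
                 (All.universal (λ σ → cong (λ k → does ((k ≡ᵇ r) ≟B true)) (ones-count σ)) (shapes R N))))
  (shapes-count R N r)

colOf : Tile → ℕ
colOf (tile _ _ j) = j

rowOf : Tile → ℕ
rowOf (tile _ p _) = p

Apart : Tile → Tile → Set
Apart s t = (s ==T t) ≡ false

Distinct : List Tile → Set
Distinct = AllPairs Apart

==K-sound : ∀ k k' → (k ==K k') ≡ true → k ≡ k'
==K-sound sqK    sqK    _ = refl
==K-sound tallK  tallK  _ = refl
==K-sound shortK shortK _ = refl
==K-sound sqK    tallK  ()
==K-sound sqK    shortK ()
==K-sound tallK  sqK    ()
==K-sound tallK  shortK ()
==K-sound shortK sqK    ()
==K-sound shortK tallK  ()

==K-refl : ∀ k → (k ==K k) ≡ true
==K-refl sqK    = refl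
==K-refl tallK  = refl
==K-refl shortK = refl

==T-refl : ∀ t → (t ==T t) ≡ true
==T-refl (tile k p j) rewrite ==K-refl k | ≡ᵇ-refl p | ≡ᵇ-refl j = refl

==T-sound : ∀ s t → (s ==T t) ≡ true → s ≡ t
==T-sound (tile k p j) (tile k' p' j') e
  with k ==K k' in ek | p ≡ᵇ p' in ep | j ≡ᵇ j' in ej
... | true | true | true
  with refl ← ==K-sound k k' ek
     | refl ← ℕ.≡ᵇ⇒≡ p p' (Equivalence.from T-≡ ep)
     | refl ← ℕ.≡ᵇ⇒≡ j j' (Equivalence.from T-≡ ej) = refl

apart : ∀ s t → ¬ s ≡ t → Apart s t
apart s t s≢t with s ==T t in e
... | false = refl
... | true  = ⊥-elim (s≢t (==T-sound s t e))

apart-col : ∀ s t → ¬ colOf s ≡ colOf t → Apart s t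
apart-col s t ne = apart s t (ne ∘ cong colOf)

distinct-rows : ∀ k j {ps : List ℕ} → AllPairs (λ p q → ¬ p ≡ q) ps → Distinct (map (λ p → tile k p j) ps)
distinct-rows k j ps = AllPairsP.map⁺ (AllPairs.map (λ {p} {q} ne → apart (tile k p j) (tile k q j) (ne ∘ cong rowOf)) ps)

vstrip-col : ∀ σ j → All (λ t → colOf t ≡ j) (vstrip σ j)
vstrip-col σ j = AllP.++⁺ (inColumn sqK (reverse (filter (λ p → (p ≤ᵇ j) ≟B true) (zts σ))))
                          (inColumn shortK (reverse (filter (λ i → (i <ᵇ j) ≟B true) (ones σ))))
  where
    inColumn : ∀ k (xs : List ℕ) → All (λ t → colOf t ≡ j) (map (λ p → tile k p j) xs)
    inColumn k xs = AllP.map⁺ (All.universal (λ _ → refl) xs)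

hstrip-col : ∀ σ p → All (λ t → colOf t ≤ length σ) (hstrip σ p)
hstrip-col σ p = AllP.map⁺ (All.map (λ {j} r → bounded j (is1 σ j) (proj₂ r)) (AllP.filter⁺ _ (positions-inRange (length σ))))
  where
    bounded : ∀ j c → j ≤ length σ → colOf (if c then tile tallK p j else tile sqK p j) ≤ length σ
    bounded j true  j≤ = j≤
    bounded j false j≤ = j≤

allTiles-col : ∀ σ → All (λ t → colOf t ≤ length σ) (allTiles σ)
allTiles-col σ = AllP.++⁺
  (AllP.concat⁺ (AllP.map⁺ (All.map (λ {j} r → All.map (λ e → ≡.subst (_≤ length σ) (≡.sym e) (proj₂ r)) (vstrip-col σ j))
                                    (zts-inRange σ))))
  (AllP.concat⁺ (AllP.map⁺ (All.map (λ r → AllP.map⁺ (All.universal (λ _ → proj₂ r) _)) (ones-inRange σ))))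

newColumn : List Bool → Bool → List Tile
newColumn σ false = vstrip (σ ++ [ false ]) (suc (length σ))
newColumn σ true  = map (λ p → tile tallK p (suc (length σ))) (zts σ)

newColumn-col : ∀ σ b → All (λ t → colOf t ≡ suc (length σ)) (newColumn σ b)
newColumn-col σ false = vstrip-col (σ ++ [ false ]) (suc (length σ))
newColumn-col σ true  = AllP.map⁺ (All.universal (λ _ → refl) (zts σ))

allTiles-ext-02 : ∀ σ → let open Extend σ false in
                  allTiles σ⁺ ≡ old02 ++ (newColumn σ false ++ old1)
allTiles-ext-02 σ = begin
    concatMap (vstrip σ⁺) (zts σ⁺) ++ concatMap (oneColumn σ⁺) (ones σ⁺)
  ≡⟨ cong₂ (λ zs os → concatMap (vstrip σ⁺) zs ++ concatMap (oneColumn σ⁺) os) zts⁺ (≡.trans ones⁺ (List.++-identityʳ _)) ⟩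
    concatMap (vstrip σ⁺) (zts σ ++ [ suc N ]) ++ concatMap (oneColumn σ⁺) (ones σ)
  ≡⟨ cong₂ _++_ (List.concatMap-++ (vstrip σ⁺) (zts σ) [ suc N ]) old1⁺ ⟩
    (concatMap (vstrip σ⁺) (zts σ) ++ (vstrip σ⁺ (suc N) ++ [])) ++ old1
  ≡⟨ cong₂ (λ xs ys → (xs ++ ys) ++ old1) old02⁺ (List.++-identityʳ _) ⟩
    (old02 ++ vstrip σ⁺ (suc N)) ++ old1
  ≡⟨ List.++-assoc old02 _ old1 ⟩
    old02 ++ (vstrip σ⁺ (suc N) ++ old1) ∎
  where open Extend σ false
        open ≡.≡-Reasoning

allTiles-ext-1 : ∀ σ → let open Extend σ true in allTiles σ⁺ ≡ allTiles σ ++ newColumn σ true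
allTiles-ext-1 σ = begin
    concatMap (vstrip σ⁺) (zts σ⁺) ++ concatMap (oneColumn σ⁺) (ones σ⁺)
  ≡⟨ cong₂ (λ zs os → concatMap (vstrip σ⁺) zs ++ concatMap (oneColumn σ⁺) os) (≡.trans zts⁺ (List.++-identityʳ _)) ones⁺ ⟩
    concatMap (vstrip σ⁺) (zts σ) ++ concatMap (oneColumn σ⁺) (ones σ ++ [ suc N ])
  ≡⟨ cong₂ _++_ old02⁺ (List.concatMap-++ (oneColumn σ⁺) (ones σ) [ suc N ]) ⟩
    old02 ++ (concatMap (oneColumn σ⁺) (ones σ) ++ (oneColumn σ⁺ (suc N) ++ []))
  ≡⟨ cong₂ (λ xs ys → old02 ++ (xs ++ ys)) old1⁺ (≡.trans (List.++-identityʳ _) lastColumn) ⟩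
    old02 ++ (old1 ++ newColumn σ true)
  ≡⟨ List.++-assoc old02 old1 _ ⟨
    (old02 ++ old1) ++ newColumn σ true ∎
  where
    open Extend σ true
    open ≡.≡-Reasoning
    lastColumn : oneColumn σ⁺ (suc N) ≡ newColumn σ true
    lastColumn = cong (map (λ p → tile tallK p (suc N)))
      (≡.trans (cong (filter _) (≡.trans zts⁺ (List.++-identityʳ _)))
               (List.filter-all _ (All.map (λ r → <ᵇ-true (s≤s (proj₂ r))) (zts-inRange σ))))

module NewStrip (σ : List Bool) where
  open Extend σ false

  corner : Tile
  corner = tile sqK (suc N) (suc N)

  squares : List Tile
  squares = map (λ p → tile sqK p (suc N)) (reverse (zts σ))

  shorts : List Tile
  shorts = map (λ i → tile shortK i (suc N)) (reverse (ones σ))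

  newStrip : newColumn σ false ≡ corner ∷ (squares ++ shorts)
  newStrip = ≡.trans
    (cong₂ (λ xs ys → map (λ p → tile sqK p (suc N)) (reverse xs) ++ map (λ i → tile shortK i (suc N)) (reverse ys))
      (≡.trans (cong (filter _) zts⁺)
               (List.filter-all _ (AllP.++⁺ (All.map (λ r → ≤ᵇ-true (ℕ.m≤n⇒m≤1+n (proj₂ r))) (zts-inRange σ))
                                             (≤ᵇ-true (ℕ.≤-refl {suc N}) ∷ []))))
      (≡.trans (cong (filter _) (≡.trans ones⁺ (List.++-identityʳ _)))
               (List.filter-all _ (All.map (λ r → <ᵇ-true (s≤s (proj₂ r))) (ones-inRange σ)))))
    (cong (λ xs → map (λ p → tile sqK p (suc N)) xs ++ shorts) (List.reverse-++ (zts σ) [ suc N ]))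

  squareShort : ∀ p → All (Apart (tile sqK p (suc N))) shorts
  squareShort p = AllP.map⁺ (All.universal (λ _ → refl) (reverse (ones σ)))

  newStrip-distinct : Distinct (corner ∷ (squares ++ shorts))
  newStrip-distinct =
    AllP.++⁺ (AllP.map⁺ (All.map (λ {p} r → apart corner (tile sqK p (suc N)) (λ e → ℕ.<⇒≢ (s≤s (proj₂ r)) (≡.sym (cong rowOf e))))
                                 (All-reverse (zts-inRange σ))))
             (squareShort (suc N))
    ∷ AllPairsP.++⁺ (distinct-rows sqK (suc N) (AllPairs-reverse (_∘ ≡.sym) (zts-distinct σ)))
                    (distinct-rows shortK (suc N) (AllPairs-reverse (_∘ ≡.sym) (ones-distinct σ)))
                    (AllP.map⁺ (All.universal squareShort (reverse (zts σ))))

apart-from-old : ∀ N v t → colOf v ≡ suc N → colOf t ≤ N → Apart v t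
apart-from-old N v t cv ct = apart-col v t (λ e → ℕ.1+n≰n (≡.subst (_≤ N) (≡.trans (≡.sym e) cv) ct))

newColumn-apart : ∀ σ b → All (λ v → All (Apart v) (allTiles σ)) (newColumn σ b)
newColumn-apart σ b = All.map (λ {v} cv → All.map (λ {t} → apart-from-old _ v t cv) (allTiles-col σ)) (newColumn-col σ b)

newColumn-apart-from : ∀ σ b t → colOf t ≤ length σ → All (λ v → Apart v t) (newColumn σ b)
newColumn-apart-from σ b t ct = All.map (λ {v} cv → apart-from-old _ v t cv ct) (newColumn-col σ b)

module BigOperators {c ℓ} (R : CommutativeSemiring c ℓ) where
  open CommutativeSemiring R renaming (refl to ≈-refl)
  open import Relation.Binary.Reasoning.Setoid setoid
  open import Algebra.Properties.CommutativeSemigroup +-commutativeSemigroup using () renaming (interchange to +-interchange)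
  open import Algebra.Properties.CommutativeSemigroup *-commutativeSemigroup using () renaming (interchange to *-interchange)

  sumOf : {A : Set} → List A → (A → Carrier) → Carrier
  sumOf xs G = sumL R (map G xs)

  prodOf : {A : Set} → List A → (A → Carrier) → Carrier
  prodOf xs G = prodL R (map G xs)

  module _ {A : Set} where

    sumOf-cong : ∀ (xs : List A) {G H} → (∀ x → G x ≈ H x) → sumOf xs G ≈ sumOf xs H
    sumOf-cong []       e = ≈-refl
    sumOf-cong (x ∷ xs) e = +-cong (e x) (sumOf-cong xs e)

    sumOf-++ : ∀ (xs ys : List A) G → sumOf (xs ++ ys) G ≈ sumOf xs G + sumOf ys G
    sumOf-++ []       ys G = sym (+-identityˡ _)
    sumOf-++ (x ∷ xs) ys G = trans (+-congˡ (sumOf-++ xs ys G)) (sym (+-assoc _ _ _))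

    sumOf-0 : ∀ (xs : List A) → sumOf xs (λ _ → 0#) ≈ 0#
    sumOf-0 []       = ≈-refl
    sumOf-0 (x ∷ xs) = trans (+-identityˡ _) (sumOf-0 xs)

    sumOf-+ : ∀ (xs : List A) G H → sumOf xs (λ x → G x + H x) ≈ sumOf xs G + sumOf xs H
    sumOf-+ []       G H = sym (+-identityˡ 0#)
    sumOf-+ (x ∷ xs) G H = trans (+-congˡ (sumOf-+ xs G H)) (+-interchange _ _ _ _)

    sumOf-*ˡ : ∀ (xs : List A) k G → sumOf xs (λ x → k * G x) ≈ k * sumOf xs G
    sumOf-*ˡ []       k G = sym (zeroʳ k)
    sumOf-*ˡ (x ∷ xs) k G = trans (+-congˡ (sumOf-*ˡ xs k G)) (sym (distribˡ k _ _))

    sumOf-*ʳ : ∀ (xs : List A) G k → sumOf xs (λ x → G x * k) ≈ sumOf xs G * k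
    sumOf-*ʳ xs G k = trans (sumOf-cong xs (λ x → *-comm (G x) k)) (trans (sumOf-*ˡ xs k G) (*-comm k _))

    sumOf-const : ∀ (G : A → Carrier) K xs → All (λ x → G x ≈ K) xs → sumOf xs G ≈ fromℕ R (length xs) * K
    sumOf-const G K []       []       = sym (zeroˡ K)
    sumOf-const G K (x ∷ xs) (e ∷ es) =
      trans (+-cong e (sumOf-const G K xs es)) (trans (+-congʳ (sym (*-identityˡ K))) (sym (distribʳ K 1# _)))

    prodOf-cong : ∀ (xs : List A) {G H} → (∀ x → G x ≈ H x) → prodOf xs G ≈ prodOf xs H
    prodOf-cong []       e = ≈-refl
    prodOf-cong (x ∷ xs) e = *-cong (e x) (prodOf-cong xs e)

    prodOf-congAll : ∀ {xs : List A} {G H} → All (λ x → G x ≈ H x) xs → prodOf xs G ≈ prodOf xs H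
    prodOf-congAll []       = ≈-refl
    prodOf-congAll (e ∷ es) = *-cong e (prodOf-congAll es)

    prodOf-++ : ∀ (xs ys : List A) G → prodOf (xs ++ ys) G ≈ prodOf xs G * prodOf ys G
    prodOf-++ []       ys G = sym (*-identityˡ _)
    prodOf-++ (x ∷ xs) ys G = trans (*-congˡ (prodOf-++ xs ys G)) (sym (*-assoc _ _ _))

    prodOf-1 : ∀ (xs : List A) → prodOf xs (λ _ → 1#) ≈ 1#
    prodOf-1 []       = ≈-refl
    prodOf-1 (x ∷ xs) = trans (*-identityˡ _) (prodOf-1 xs)

    prodOf-* : ∀ (xs : List A) G H → prodOf xs (λ x → G x * H x) ≈ prodOf xs G * prodOf xs H
    prodOf-* []       G H = sym (*-identityˡ 1#)
    prodOf-* (x ∷ xs) G H = trans (*-congˡ (prodOf-* xs G H)) (*-interchange _ _ _ _)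

    prodOf-reverse : ∀ (xs : List A) G → prodOf (reverse xs) G ≈ prodOf xs G
    prodOf-reverse []       G = ≈-refl
    prodOf-reverse (x ∷ xs) G = begin
      prodOf (reverse (x ∷ xs)) G     ≡⟨ cong (λ l → prodOf l G) (List.unfold-reverse x xs) ⟩
      prodOf (reverse xs ++ [ x ]) G  ≈⟨ prodOf-++ (reverse xs) [ x ] G ⟩
      prodOf (reverse xs) G * (G x * 1#) ≈⟨ *-cong (prodOf-reverse xs G) (*-identityʳ _) ⟩
      prodOf xs G * G x               ≈⟨ *-comm _ _ ⟩
      G x * prodOf xs G               ∎

  module _ {A B : Set} where

    sumOf-map : ∀ (u : A → B) xs G → sumOf (map u xs) G ≡ sumOf xs (G ∘ u)
    sumOf-map u xs G = cong (sumL R) (≡.sym (List.map-∘ xs))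

    prodOf-map : ∀ (u : A → B) xs G → prodOf (map u xs) G ≡ prodOf xs (G ∘ u)
    prodOf-map u xs G = cong (prodL R) (≡.sym (List.map-∘ xs))

    sumOf-concatMap : ∀ (h : A → List B) xs G → sumOf (concatMap h xs) G ≈ sumOf xs (λ x → sumOf (h x) G)
    sumOf-concatMap h []       G = ≈-refl
    sumOf-concatMap h (x ∷ xs) G = trans (sumOf-++ (h x) (concatMap h xs) G) (+-congˡ (sumOf-concatMap h xs G))

    sumOf-swap : ∀ xs ys (φ : A → B → Carrier) →
                 sumOf xs (λ x → sumOf ys (φ x)) ≈ sumOf ys (λ y → sumOf xs (λ x → φ x y))
    sumOf-swap []       ys φ = sym (sumOf-0 ys)
    sumOf-swap (x ∷ xs) ys φ = trans (+-congˡ (sumOf-swap xs ys φ)) (sym (sumOf-+ ys (φ x) _))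

  ind : Bool → Carrier
  ind true  = 1#
  ind false = 0#

  ind-∧ : ∀ x y → ind (x ∧ y) ≈ ind x * ind y
  ind-∧ true  y = sym (*-identityˡ _)
  ind-∧ false y = sym (zeroˡ _)

  ind-allB : ∀ {A : Set} (P : A → Bool) xs → ind (allB P xs) ≈ prodOf xs (ind ∘ P)
  ind-allB P []       = ≈-refl
  ind-allB P (x ∷ xs) = trans (ind-∧ (P x) _) (*-congˡ (ind-allB P xs))

  sumOf-filter : ∀ {A : Set} (v : A → Bool) xs G →
                 sumOf (filter (λ x → v x ≟B true) xs) G ≈ sumOf xs (λ x → ind (v x) * G x)
  sumOf-filter v []       G = ≈-refl
  sumOf-filter v (x ∷ xs) G with v x
  ... | true  = +-cong (sym (*-identityˡ _)) (sumOf-filter v xs G)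
  ... | false = trans (sumOf-filter v xs G) (sym (trans (+-congʳ (zeroˡ _)) (+-identityˡ _)))

-- A labelling assigns a label to every tile;
-- sumLab ts g G sums G over all labellings that give each tile of ts one of
-- its allowed labels and agree with g elsewhere.  Summing over the fillings
-- of Defs is the case g = (everything empty).

module LabellingSums {c ℓ} (R : CommutativeSemiring c ℓ) where
  open CommutativeSemiring R renaming (refl to ≈-refl)
  open import Relation.Binary.Reasoning.Setoid setoid
  open BigOperators R

  open import Algebra.Properties.CommutativeSemigroup *-commutativeSemigroup using (x∙yz≈y∙xz; interchange)

  vanish : ∀ x r → 0# * x + r ≈ r
  vanish x r = trans (+-congʳ (zeroˡ x)) (+-identityˡ r)

  Labelling : Set
  Labelling = Tile → Lbl

  update : Tile → Lbl → Labelling → Labelling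
  update t l f x = if t ==T x then l else f x

  sumLab : List Tile → Labelling → (Labelling → Carrier) → Carrier
  sumLab []       g G = G g
  sumLab (t ∷ ts) g G = sumOf (allowed t) (λ l → sumLab ts g (G ∘ update t l))

  AgreeOff : List Tile → Labelling → Labelling → Set
  AgreeOff ts f h = ∀ x → All (λ t → Apart t x) ts → f x ≡ h x

  -- G only depends on the values of the labelling (there is no function
  -- extensionality, so this is an explicit hypothesis).
  Extensional : (Labelling → Carrier) → Set ℓ
  Extensional G = ∀ f g → (∀ x → f x ≡ g x) → G f ≈ G g

  update-miss : ∀ t l f x → Apart t x → update t l f x ≡ f x
  update-miss t l f x d rewrite d = refl

  update-hit : ∀ t l f → update t l f t ≡ l
  update-hit t l f rewrite ==T-refl t = refl

  update-comm : ∀ v t l l' k → Apart v t → ∀ x → update t l' (update v l k) x ≡ update v l (update t l' k) x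
  update-comm v t l l' k d x with t ==T x in e₁ | v ==T x in e₂
  ... | false | false = refl
  ... | false | true  = refl
  ... | true  | false = refl
  ... | true  | true  with refl ← ==T-sound t x e₁ | refl ← ==T-sound v x e₂
                      with () ← ≡.trans (≡.sym d) (==T-refl t)

  update-extensional : ∀ {G} t l → Extensional G → Extensional (G ∘ update t l)
  update-extensional t l ext f g e = ext _ _ (λ x → cong (if t ==T x then l else_) (e x))

  sumLab-local : ∀ ts h {G H : Labelling → Carrier} → (∀ f → AgreeOff ts f h → G f ≈ H f) →
                 sumLab ts h G ≈ sumLab ts h H
  sumLab-local []       h hyp = hyp h (λ _ _ → refl)
  sumLab-local (t ∷ ts) h hyp = sumOf-cong (allowed t) (λ l → sumLab-local ts h
    (λ f ag → hyp (update t l f) (λ { x (d ∷ ds) → ≡.trans (update-miss t l f x d) (ag x ds) })))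

  sumLab-cong : ∀ ts h {G H : Labelling → Carrier} → (∀ f → G f ≈ H f) → sumLab ts h G ≈ sumLab ts h H
  sumLab-cong ts h e = sumLab-local ts h (λ f _ → e f)

  sumLab-*ˡ : ∀ ts h k G → sumLab ts h (λ f → k * G f) ≈ k * sumLab ts h G
  sumLab-*ˡ []       h k G = ≈-refl
  sumLab-*ˡ (t ∷ ts) h k G =
    trans (sumOf-cong (allowed t) (λ l → sumLab-*ˡ ts h k (G ∘ update t l))) (sumOf-*ˡ (allowed t) k _)

  sumLab-factor : ∀ ts h k (G H : Labelling → Carrier) → (∀ f → AgreeOff ts f h → G f ≈ k * H f) →
                  sumLab ts h G ≈ k * sumLab ts h H
  sumLab-factor ts h k G H hyp = trans (sumLab-local ts h hyp) (sumLab-*ˡ ts h k H)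

  sumLab-sumOf : ∀ {A : Set} ts h (xs : List A) (φ : Labelling → A → Carrier) →
                 sumLab ts h (λ f → sumOf xs (φ f)) ≈ sumOf xs (λ x → sumLab ts h (λ f → φ f x))
  sumLab-sumOf []       h xs φ = ≈-refl
  sumLab-sumOf (t ∷ ts) h xs φ =
    trans (sumOf-cong (allowed t) (λ l → sumLab-sumOf ts h xs (φ ∘ update t l)))
          (sumOf-swap (allowed t) xs (λ l x → sumLab ts h (λ f → φ (update t l f) x)))

  sumLab-++ : ∀ ts us h G → sumLab (ts ++ us) h G ≈ sumLab us h (λ f → sumLab ts f G)
  sumLab-++ []       us h G = ≈-refl
  sumLab-++ (t ∷ ts) us h G =
    trans (sumOf-cong (allowed t) (λ l → sumLab-++ ts us h (G ∘ update t l)))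
          (sym (sumLab-sumOf us h (allowed t) (λ f l → sumLab ts f (G ∘ update t l))))

  sumLab-update : ∀ ts v l f G → Extensional G → All (Apart v) ts →
                  sumLab ts (update v l f) G ≈ sumLab ts f (G ∘ update v l)
  sumLab-update []       v l f G ext ds = ≈-refl
  sumLab-update (t ∷ ts) v l f G ext (d ∷ ds) = sumOf-cong (allowed t) (λ l' →
    trans (sumLab-update ts v l f (G ∘ update t l') (update-extensional t l' ext) ds)
          (sumLab-cong ts f (λ k → ext _ _ (update-comm v t l l' k d))))

  sumLab-comm : ∀ vs ts h G → Extensional G → All (λ v → All (Apart v) ts) vs →
                sumLab vs h (λ f → sumLab ts f G) ≈ sumLab ts h (λ f → sumLab vs f G)
  sumLab-comm []       ts h G ext _ = ≈-refl
  sumLab-comm (v ∷ vs) ts h G ext (d ∷ ds) =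
    trans (sumOf-cong (allowed v) (λ l →
             trans (sumLab-cong vs h (λ f → sumLab-update ts v l f G ext d))
                   (sumLab-comm vs ts h (G ∘ update v l) (update-extensional v l ext) ds)))
          (sym (sumLab-sumOf ts h (allowed v) (λ f l → sumLab vs f (G ∘ update v l))))

  sumLab-fillings : ∀ ts G → sumOf (fillings ts) (G ∘ lab) ≈ sumLab ts (λ _ → Emp) G
  sumLab-fillings []       G = +-identityʳ _
  sumLab-fillings (t ∷ ts) G =
    trans (sumOf-concatMap (λ l → map ((t , l) ∷_) (fillings ts)) (allowed t) _)
          (sumOf-cong (allowed t) (λ l → ≡.subst (_≈ sumLab ts (λ _ → Emp) (G ∘ update t l))
                                                  (≡.sym (sumOf-map ((t , l) ∷_) (fillings ts) (G ∘ lab)))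
                                                  (sumLab-fillings ts (G ∘ update t l))))

  map-update-miss : ∀ t l f X → All (Apart t) X → map (update t l f) X ≡ map f X
  map-update-miss t l f []       []       = refl
  map-update-miss t l f (s ∷ X) (d ∷ ds) = cong₂ _∷_ (update-miss t l f s d) (map-update-miss t l f X ds)

  prodOf-update-miss : ∀ t l f X (φ : Tile → Lbl → Carrier) → All (Apart t) X →
                       prodOf X (λ s → φ s (update t l f s)) ≈ prodOf X (λ s → φ s (f s))
  prodOf-update-miss t l f []       φ []       = ≈-refl
  prodOf-update-miss t l f (s ∷ X) φ (d ∷ ds) =
    *-cong (reflexive (cong (φ s) (update-miss t l f s d))) (prodOf-update-miss t l f X φ ds)

  prodOf-update : ∀ t l f X (φ : Tile → Lbl → Carrier) → All (Apart t) X →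
                  prodOf (t ∷ X) (λ s → φ s (update t l f s)) ≈ φ t l * prodOf X (λ s → φ s (f s))
  prodOf-update t l f X φ ds =
    *-cong (reflexive (cong (φ t) (update-hit t l f))) (prodOf-update-miss t l f X φ ds)

  sumLab-independent : ∀ X h (φ : Tile → Lbl → Carrier) → Distinct X →
                       sumLab X h (λ f → prodOf X (λ t → φ t (f t))) ≈ prodOf X (λ t → sumOf (allowed t) (φ t))
  sumLab-independent []      h φ []        = ≈-refl
  sumLab-independent (t ∷ X) h φ (ds ∷ dX) =
    trans (sumOf-cong (allowed t) (λ l →
            trans (sumLab-cong X h (λ f → prodOf-update t l f X φ ds))
                  (trans (sumLab-*ˡ X h (φ t l) _) (*-congˡ (sumLab-independent X h φ dX)))))
          (sumOf-*ʳ (allowed t) (φ t) _)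

  sumOf-empty : ∀ t (ψ : Lbl → Carrier) → sumOf (allowed t) (λ l → ind (isE l) * ψ l) ≈ ψ Emp
  sumOf-empty (tile sqK    _ _) ψ =
    trans (+-cong (*-identityˡ _) (trans (vanish _ _) (trans (vanish _ _) (trans (vanish _ _) (vanish _ _))))) (+-identityʳ _)
  sumOf-empty (tile tallK  _ _) ψ = trans (+-cong (*-identityˡ _) (trans (vanish _ _) (vanish _ _))) (+-identityʳ _)
  sumOf-empty (tile shortK _ _) ψ = trans (+-cong (*-identityˡ _) (trans (vanish _ _) (vanish _ _))) (+-identityʳ _)

  sumLab-empty : ∀ X h (φ : Tile → Lbl → Carrier) → Distinct X →
                 sumLab X h (λ f → ind (allB isE (map f X)) * prodOf X (λ t → φ t (f t))) ≈ prodOf X (λ t → φ t Emp)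
  sumLab-empty []      h φ []        = *-identityˡ _
  sumLab-empty (t ∷ X) h φ (ds ∷ dX) =
    trans (sumOf-cong (allowed t) (λ l →
            trans (sumLab-cong X h (λ f → trans (*-cong (indicator l f) (prodOf-update t l f X φ ds)) (interchange _ _ _ _)))
                  (trans (sumLab-*ˡ X h _ _) (*-congˡ (sumLab-empty X h φ dX)))))
          (trans (sumOf-*ʳ (allowed t) (λ l → ind (isE l) * φ t l) _) (*-congʳ (sumOf-empty t (φ t))))
    where
      indicator : ∀ l f → ind (allB isE (map (update t l f) (t ∷ X))) ≈ ind (isE l) * ind (allB isE (map f X))
      indicator l f = trans (reflexive (cong₂ (λ u v → ind (isE u ∧ allB isE v)) (update-hit t l f) (map-update-miss t l f X ds)))
                            (ind-∧ (isE l) _)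

  -- A strip read in order, in which every tile after an α or γ must be empty
  -- (the column condition of a rhombic staircase tableau).
  stripSum : (Tile → Lbl → Carrier) → List Tile → Carrier
  stripSum φ []      = 1#
  stripSum φ (t ∷ X) = sumOf (allowed t) (λ l → φ t l * (if isAC l then prodOf X (λ s → φ s Emp) else stripSum φ X))

  sumLab-strip : ∀ X h (φ : Tile → Lbl → Carrier) → Distinct X →
                 sumLab X h (λ f → ind (closedAfter isAC (map f X)) * prodOf X (λ t → φ t (f t))) ≈ stripSum φ X
  sumLab-strip []      h φ []        = *-identityˡ _
  sumLab-strip (t ∷ X) h φ (ds ∷ dX) = sumOf-cong (allowed t) (λ l →
    trans (sumLab-cong X h (λ f → *-cong (reflexive (cong₂ (λ u v → ind (closedAfter isAC (u ∷ v))) (update-hit t l f) (map-update-miss t l f X ds)))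
                                         (prodOf-update t l f X φ ds)))
    (trans (sumLab-cong X h (λ f → x∙yz≈y∙xz _ _ _))
    (trans (sumLab-*ˡ X h (φ t l) _) (*-congˡ (rest l)))))
    where
      rest : ∀ l → sumLab X h (λ f → ind (closedAfter isAC (l ∷ map f X)) * prodOf X (λ s → φ s (f s)))
                   ≈ (if isAC l then prodOf X (λ s → φ s Emp) else stripSum φ X)
      rest l with isAC l
      ... | true  = sumLab-empty X h φ dX
      ... | false = sumLab-strip X h φ dX

  sumLab-ext : ∀ σ b g G → Extensional G →
               sumLab (allTiles (σ ++ [ b ])) g G ≈ sumLab (allTiles σ) g (λ h → sumLab (newColumn σ b) h G)
  sumLab-ext σ false g G ext = begin
      sumLab (allTiles σ⁺) g G
    ≡⟨ cong (λ ts → sumLab ts g G) (allTiles-ext-02 σ) ⟩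
      sumLab (old02 ++ (V ++ old1)) g G
    ≈⟨ sumLab-++ old02 (V ++ old1) g G ⟩
      sumLab (V ++ old1) g (λ h → sumLab old02 h G)
    ≈⟨ sumLab-++ V old1 g _ ⟩
      sumLab old1 g (λ h → sumLab V h (λ h' → sumLab old02 h' G))
    ≈⟨ sumLab-cong old1 g (λ h → sumLab-comm V old02 h G ext (All.map (AllP.++⁻ˡ old02) (newColumn-apart σ false))) ⟩
      sumLab old1 g (λ h → sumLab old02 h (λ h' → sumLab V h' G))
    ≈⟨ sumLab-++ old02 old1 g _ ⟨
      sumLab (old02 ++ old1) g (λ h → sumLab V h G) ∎
    where
      open Extend σ false
      V = newColumn σ false
  sumLab-ext σ true g G ext = begin
      sumLab (allTiles σ⁺) g G
    ≡⟨ cong (λ ts → sumLab ts g G) (allTiles-ext-1 σ) ⟩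
      sumLab (allTiles σ ++ newColumn σ true) g G
    ≈⟨ sumLab-++ (allTiles σ) (newColumn σ true) g G ⟩
      sumLab (newColumn σ true) g (λ h → sumLab (allTiles σ) h G)
    ≈⟨ sumLab-comm (newColumn σ true) (allTiles σ) g G ext (newColumn-apart σ true) ⟩
      sumLab (allTiles σ) g (λ h → sumLab (newColumn σ true) h G) ∎
    where open Extend σ true

-- At q = u = 1 every empty tile has weight 1, so w(T) is the product of the
-- labels α, β, γ, δ of T.

module AtOne {c ℓ} (R : CommutativeSemiring c ℓ) (α β γ δ : CommutativeSemiring.Carrier R) where
  open CommutativeSemiring R renaming (refl to ≈-refl)
  open BigOperators R
  open LabellingSums R
  open Weights R α β γ δ 1# 1#
  open import Relation.Binary.Reasoning.Setoid setoid
  open import Algebra.Properties.CommutativeSemigroup *-commutativeSemigroup using (x∙yz≈xz∙y; x∙yz≈y∙xz; interchange)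
  open import Algebra.Solver.Ring.NaturalCoefficients.Default R using (solve; _:+_; _:*_; _:=_; con)

  lw : Lbl → Carrier
  lw Emp = 1#
  lw Al  = α
  lw Be  = β
  lw Ga  = γ
  lw De  = δ

  emptyW-one : ∀ k x y → emptyW k x y ≈ 1#
  emptyW-one sqK    nothing    y          = ≈-refl
  emptyW-one sqK    (just Emp) y          = ≈-refl
  emptyW-one sqK    (just Be)  y          = ≈-refl
  emptyW-one sqK    (just De)  y          = ≈-refl
  emptyW-one sqK    (just Al)  nothing    = ≈-refl
  emptyW-one sqK    (just Al)  (just Emp) = ≈-refl
  emptyW-one sqK    (just Al)  (just Al)  = ≈-refl
  emptyW-one sqK    (just Al)  (just Be)  = ≈-refl
  emptyW-one sqK    (just Al)  (just Ga)  = ≈-refl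
  emptyW-one sqK    (just Al)  (just De)  = ≈-refl
  emptyW-one sqK    (just Ga)  nothing    = ≈-refl
  emptyW-one sqK    (just Ga)  (just Emp) = ≈-refl
  emptyW-one sqK    (just Ga)  (just Al)  = ≈-refl
  emptyW-one sqK    (just Ga)  (just Be)  = ≈-refl
  emptyW-one sqK    (just Ga)  (just Ga)  = ≈-refl
  emptyW-one sqK    (just Ga)  (just De)  = ≈-refl
  emptyW-one tallK  nothing    y          = ≈-refl
  emptyW-one tallK  (just Emp) y          = ≈-refl
  emptyW-one tallK  (just Al)  y          = *-identityˡ 1#
  emptyW-one tallK  (just Be)  y          = *-identityˡ 1#
  emptyW-one tallK  (just Ga)  y          = *-identityˡ 1#
  emptyW-one tallK  (just De)  y          = *-identityˡ 1#
  emptyW-one shortK x          nothing    = ≈-refl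
  emptyW-one shortK x          (just Emp) = ≈-refl
  emptyW-one shortK x          (just Al)  = *-identityˡ 1#
  emptyW-one shortK x          (just Be)  = *-identityˡ 1#
  emptyW-one shortK x          (just Ga)  = *-identityˡ 1#
  emptyW-one shortK x          (just De)  = *-identityˡ 1#

  tileW-one : ∀ σ F t → tileW σ F t ≈ lw (lab F t)
  tileW-one σ F (tile k p j) with lab F (tile k p j)
  ... | Emp = emptyW-one k _ _
  tileW-one σ F (tile sqK    p j) | Al = ≈-refl
  tileW-one σ F (tile tallK  p j) | Al = ≈-refl
  tileW-one σ F (tile shortK p j) | Al = *-identityʳ α
  tileW-one σ F (tile sqK    p j) | Be = ≈-refl
  tileW-one σ F (tile tallK  p j) | Be = *-identityʳ β
  tileW-one σ F (tile shortK p j) | Be = ≈-refl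
  tileW-one σ F (tile sqK    p j) | Ga = ≈-refl
  tileW-one σ F (tile tallK  p j) | Ga = ≈-refl
  tileW-one σ F (tile shortK p j) | Ga = *-identityʳ γ
  tileW-one σ F (tile sqK    p j) | De = ≈-refl
  tileW-one σ F (tile tallK  p j) | De = *-identityʳ δ
  tileW-one σ F (tile shortK p j) | De = ≈-refl

  weight-one : ∀ σ F → weight σ F ≈ prodOf (allTiles σ) (lw ∘ lab F)
  weight-one σ F = prodOf-cong (allTiles σ) (tileW-one σ F)

  labelProd : List Bool → Labelling → Carrier
  labelProd σ f = prodOf (allTiles σ) (lw ∘ f)

  labelProd-ext : ∀ σ b f → labelProd (σ ++ [ b ]) f ≈ labelProd σ f * prodOf (newColumn σ b) (lw ∘ f)
  labelProd-ext σ false f = begin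
      labelProd σ⁺ f
    ≡⟨ cong (λ ts → prodOf ts (lw ∘ f)) (allTiles-ext-02 σ) ⟩
      prodOf (old02 ++ (V ++ old1)) (lw ∘ f)
    ≈⟨ trans (prodOf-++ old02 _ _) (*-congˡ (prodOf-++ V old1 _)) ⟩
      prodOf old02 (lw ∘ f) * (prodOf V (lw ∘ f) * prodOf old1 (lw ∘ f))
    ≈⟨ x∙yz≈xz∙y _ _ _ ⟩
      (prodOf old02 (lw ∘ f) * prodOf old1 (lw ∘ f)) * prodOf V (lw ∘ f)
    ≈⟨ *-congʳ (prodOf-++ old02 old1 _) ⟨
      labelProd σ f * prodOf V (lw ∘ f) ∎
    where
      open Extend σ false
      V = newColumn σ false
  labelProd-ext σ true f = begin
      labelProd σ⁺ f
    ≡⟨ cong (λ ts → prodOf ts (lw ∘ f)) (allTiles-ext-1 σ) ⟩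
      prodOf (allTiles σ ++ newColumn σ true) (lw ∘ f)
    ≈⟨ prodOf-++ (allTiles σ) _ _ ⟩
      labelProd σ f * prodOf (newColumn σ true) (lw ∘ f) ∎
    where open Extend σ true

  -- Row H_p contains a β or δ: it then cannot be extended by a nonempty tile.
  blocked : List Bool → Labelling → ℕ → Bool
  blocked σ f p = anyB isBD (map f (hstrip σ p))

  conditions : List Bool → Labelling → ℕ → Bool
  conditions σ f p = not (isE (f (tile sqK p p)))
                     ∧ (closedAfter isAC (map f (vstrip σ p)) ∧ closedAfter isBD (map f (hstrip σ p)))

  marker : Carrier → Bool → Carrier
  marker y b = if b then 1# else y

  rowWeight : List Bool → Carrier → Labelling → ℕ → Carrier
  rowWeight σ y f p = ind (conditions σ f p) * marker y (blocked σ f p)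

  -- The refined partition function  Zy σ y = Σ_T w(T) y^(number of rows of T
  -- without β, δ)  over the tableaux T of shape Γ(σ), at q = u = 1.
  refinedWeight : List Bool → Carrier → Labelling → Carrier
  refinedWeight σ y f = labelProd σ f * prodOf (zts σ) (rowWeight σ y f)

  allEmpty : Labelling
  allEmpty _ = Emp

  Zy : List Bool → Carrier → Carrier
  Zy σ y = sumLab (allTiles σ) allEmpty (refinedWeight σ y)

  valid-conditions : ∀ σ F → valid σ F ≡ allB (conditions σ (lab F)) (zts σ)
  valid-conditions σ F = ≡.trans (cong (allB _ (zts σ) ∧_) (allB-∧ _ _ (zts σ))) (allB-∧ _ _ (zts σ))

  tableauSum-Zy : ∀ σ → sumOf (tableaux σ) (weight σ) ≈ Zy σ 1#
  tableauSum-Zy σ = begin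
      sumOf (tableaux σ) (weight σ)
    ≈⟨ sumOf-filter (valid σ) (fillings (allTiles σ)) (weight σ) ⟩
      sumOf (fillings (allTiles σ)) (λ F → ind (valid σ F) * weight σ F)
    ≈⟨ sumOf-cong (fillings (allTiles σ)) summand ⟩
      sumOf (fillings (allTiles σ)) (refinedWeight σ 1# ∘ lab)
    ≈⟨ sumLab-fillings (allTiles σ) (refinedWeight σ 1#) ⟩
      Zy σ 1# ∎
    where
      unmarked : ∀ b → marker 1# b ≈ 1#
      unmarked true  = ≈-refl
      unmarked false = ≈-refl
      summand : ∀ F → ind (valid σ F) * weight σ F ≈ refinedWeight σ 1# (lab F)
      summand F = begin
          ind (valid σ F) * weight σ F
        ≈⟨ *-comm _ _ ⟩
          weight σ F * ind (valid σ F)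
        ≈⟨ *-cong (weight-one σ F) (reflexive (cong ind (valid-conditions σ F))) ⟩
          labelProd σ (lab F) * ind (allB (conditions σ (lab F)) (zts σ))
        ≈⟨ *-congˡ (ind-allB _ (zts σ)) ⟩
          labelProd σ (lab F) * prodOf (zts σ) (ind ∘ conditions σ (lab F))
        ≈⟨ *-congˡ (prodOf-cong (zts σ) (λ p → trans (sym (*-identityʳ _)) (*-congˡ (sym (unmarked _))))) ⟩
          refinedWeight σ 1# (lab F) ∎

  AgreeOn : List Bool → Labelling → Labelling → Set
  AgreeOn σ f g = ∀ t → colOf t ≤ length σ → f t ≡ g t

  module _ (σ : List Bool) {f g : Labelling} (ag : AgreeOn σ f g) where

    hstrip-agree : ∀ p → map f (hstrip σ p) ≡ map g (hstrip σ p)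
    hstrip-agree p = List.map-cong-local (All.map (ag _) (hstrip-col σ p))

    vstrip-agree : ∀ j → j ≤ length σ → map f (vstrip σ j) ≡ map g (vstrip σ j)
    vstrip-agree j j≤ = List.map-cong-local (All.map (λ e → ag _ (≡.subst (_≤ length σ) (≡.sym e) j≤)) (vstrip-col σ j))

    blocked-agree : ∀ p → blocked σ f p ≡ blocked σ g p
    blocked-agree p = cong (anyB isBD) (hstrip-agree p)

    conditions-agree : ∀ {p} → InRange (length σ) p → conditions σ f p ≡ conditions σ g p
    conditions-agree {p} (_ , p≤) =
      cong₂ (λ x ys → not (isE x) ∧ ys) (ag _ p≤)
            (cong₂ _∧_ (cong (closedAfter isAC) (vstrip-agree p p≤)) (cong (closedAfter isBD) (hstrip-agree p)))

    labelProd-agree : labelProd σ f ≈ labelProd σ g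
    labelProd-agree = prodOf-congAll (All.map (λ le → reflexive (cong lw (ag _ le))) (allTiles-col σ))

    rowConditions-agree : prodOf (zts σ) (ind ∘ conditions σ f) ≈ prodOf (zts σ) (ind ∘ conditions σ g)
    rowConditions-agree = prodOf-congAll (All.map (λ r → reflexive (cong ind (conditions-agree r))) (zts-inRange σ))

    refinedWeight-agree : ∀ y → refinedWeight σ y f ≈ refinedWeight σ y g
    refinedWeight-agree y = *-cong labelProd-agree (prodOf-congAll (All.map
      (λ r → reflexive (cong₂ (λ c b → ind c * marker y b) (conditions-agree r) (blocked-agree _))) (zts-inRange σ)))

  refinedWeight-extensional : ∀ σ y → Extensional (refinedWeight σ y)
  refinedWeight-extensional σ y f g e = refinedWeight-agree σ (λ t _ → e t) y

  -- The factor of an old row, blocked or not (d), when its new tile gets the label l: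
  -- the row condition forbids a nonempty tile after a β/δ, and the row is
  -- still free of β/δ only if it was and l is not β/δ.
  extendRow : Carrier → Bool → Lbl → Carrier
  extendRow y d l = ind (not d ∨ isE l) * marker y (d ∨ isBD l)

  oldPart : List Bool → Labelling → Carrier
  oldPart σ f = labelProd σ f * prodOf (zts σ) (ind ∘ conditions σ f)

  oldPart-agree : ∀ σ {f g} → AgreeOn σ f g → oldPart σ f ≈ oldPart σ g
  oldPart-agree σ ag = *-cong (labelProd-agree σ ag) (rowConditions-agree σ ag)

  refinedWeight-split : ∀ σ y f → refinedWeight σ y f ≈ oldPart σ f * prodOf (zts σ) (marker y ∘ blocked σ f)
  refinedWeight-split σ y f = trans (*-congˡ (prodOf-* (zts σ) _ _)) (sym (*-assoc _ _ _))

  module Step (σ : List Bool) (b : Bool) (y : Carrier) where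
    open Extend σ b

    rowWeight-old : ∀ f {p} → InRange N p →
                    rowWeight σ⁺ y f p ≈ ind (conditions σ f p) * extendRow y (blocked σ f p) (f (newTile p))
    rowWeight-old f {p} (_ , p≤N) = begin
        ind (conditions σ⁺ f p) * marker y (blocked σ⁺ f p)
      ≡⟨ cong₂ (λ c d → ind c * marker y d) conditions⁺ blocked⁺ ⟩
        ind (conditions σ f p ∧ (not (blocked σ f p) ∨ isE x)) * marker y (blocked σ f p ∨ isBD x)
      ≈⟨ *-congʳ (ind-∧ (conditions σ f p) _) ⟩
        (ind (conditions σ f p) * ind (not (blocked σ f p) ∨ isE x)) * marker y (blocked σ f p ∨ isBD x)
      ≈⟨ *-assoc _ _ _ ⟩
        ind (conditions σ f p) * extendRow y (blocked σ f p) x ∎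
      where
        x = f (newTile p)
        row⁺ : map f (hstrip σ⁺ p) ≡ map f (hstrip σ p) ++ [ x ]
        row⁺ = ≡.trans (cong (map f) (hstrip-old p p≤N)) (List.map-++ f (hstrip σ p) [ newTile p ])
        blocked⁺ : blocked σ⁺ f p ≡ blocked σ f p ∨ isBD x
        blocked⁺ = ≡.trans (cong (anyB isBD) row⁺) (anyB-snoc isBD (map f (hstrip σ p)) x)
        conditions⁺ : conditions σ⁺ f p ≡ conditions σ f p ∧ (not (blocked σ f p) ∨ isE x)
        conditions⁺ = ≡.trans
          (cong₂ (λ c r → corner ∧ (closedAfter isAC (map f c) ∧ r))
                 (vstrip-old p p≤N) (≡.trans (cong (closedAfter isBD) row⁺) (closedAfter-snoc isBD (map f (hstrip σ p)) x)))
          (≡.sym (≡.trans (∧-assoc corner (column ∧ row) extensible)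
                          (cong (corner ∧_) (∧-assoc column row extensible))))
          where
            corner = not (isE (f (tile sqK p p)))
            column = closedAfter isAC (map f (vstrip σ p))
            row = closedAfter isBD (map f (hstrip σ p))
            extensible = not (blocked σ f p) ∨ isE x

    -- The new row H_(N+1) (present only when b is false).
    newRows : Labelling → Carrier
    newRows f = prodOf (newAs false) (rowWeight σ⁺ y f)

    -- h supplies the labels of Γ(σ) (whether old rows are blocked), f those of the new column.
    newPart : Labelling → Labelling → Carrier
    newPart h f = prodOf (newColumn σ b) (lw ∘ f)
                  * (prodOf (zts σ) (λ p → extendRow y (blocked σ h p) (f (newTile p))) * newRows f)

    refinedWeight-ext : ∀ f → refinedWeight σ⁺ y f ≈ oldPart σ f * newPart f f
    refinedWeight-ext f = begin
        labelProd σ⁺ f * prodOf (zts σ⁺) (rowWeight σ⁺ y f)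
      ≈⟨ *-cong (labelProd-ext σ b f)
                (trans (reflexive (cong (λ zs → prodOf zs (rowWeight σ⁺ y f)) zts⁺)) (prodOf-++ (zts σ) (newAs false) _)) ⟩
        (labelProd σ f * column) * (prodOf (zts σ) (rowWeight σ⁺ y f) * newRows f)
      ≈⟨ *-congˡ (*-congʳ (trans (prodOf-congAll (All.map (rowWeight-old f) (zts-inRange σ))) (prodOf-* (zts σ) _ _))) ⟩
        (labelProd σ f * column) * ((prodOf (zts σ) (ind ∘ conditions σ f) * extensions) * newRows f)
      ≈⟨ trans (*-congˡ (*-assoc _ _ _)) (interchange _ _ _ _) ⟩
        oldPart σ f * newPart f f ∎
      where
        column = prodOf (newColumn σ b) (lw ∘ f)
        extensions = prodOf (zts σ) (λ p → extendRow y (blocked σ f p) (f (newTile p)))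

    refinedWeight-factor : ∀ h f → AgreeOff (newColumn σ b) f h → refinedWeight σ⁺ y f ≈ oldPart σ h * newPart h f
    refinedWeight-factor h f ag = trans (refinedWeight-ext f)
      (*-cong (oldPart-agree σ old)
              (*-congˡ (*-congʳ (prodOf-cong (zts σ) (λ p → reflexive (cong (λ d → extendRow y d _) (blocked-agree σ old p)))))))
      where
        old : AgreeOn σ f h
        old t ct = ag t (newColumn-apart-from σ b t ct)

    Zy-ext : ∀ K → (∀ h → sumLab (newColumn σ b) h (newPart h) ≈ K * prodOf (zts σ) (marker (y + (β + δ)) ∘ blocked σ h)) →
             Zy σ⁺ y ≈ K * Zy σ (y + (β + δ))
    Zy-ext K columnSum = begin
        sumLab (allTiles σ⁺) allEmpty (refinedWeight σ⁺ y)
      ≈⟨ sumLab-ext σ b allEmpty _ (refinedWeight-extensional σ⁺ y) ⟩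
        sumLab (allTiles σ) allEmpty (λ h → sumLab (newColumn σ b) h (refinedWeight σ⁺ y))
      ≈⟨ sumLab-cong (allTiles σ) allEmpty (λ h →
           trans (sumLab-factor (newColumn σ b) h (oldPart σ h) _ (newPart h) (refinedWeight-factor h))
                 (*-congˡ (columnSum h))) ⟩
        sumLab (allTiles σ) allEmpty (λ h → oldPart σ h * (K * prodOf (zts σ) (marker (y + (β + δ)) ∘ blocked σ h)))
      ≈⟨ sumLab-cong (allTiles σ) allEmpty (λ h → trans (x∙yz≈y∙xz _ _ _) (*-congˡ (sym (refinedWeight-split σ _ h)))) ⟩
        sumLab (allTiles σ) allEmpty (λ h → K * refinedWeight σ (y + (β + δ)) h)
      ≈⟨ sumLab-*ˡ (allTiles σ) allEmpty K _ ⟩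
        K * Zy σ (y + (β + δ)) ∎

  -- A new tall rhombus ρ(p, N+1) is empty, βu or δq; a β or δ is only allowed
  -- if the row is not blocked, and then blocks it.
  tallSum : ∀ y d p j → sumOf (allowed (tile tallK p j)) (λ l → lw l * extendRow y d l) ≈ marker (y + (β + δ)) d
  tallSum y false p j =
    solve 3 (λ y b d → con 1 :* (con 1 :* y) :+ (b :* (con 1 :* con 1) :+ (d :* (con 1 :* con 1) :+ con 0)) := y :+ (b :+ d))
          ≈-refl y β δ
  tallSum y true  p j =
    solve 2 (λ b d → con 1 :* (con 1 :* con 1) :+ (b :* (con 0 :* con 1) :+ (d :* (con 0 :* con 1) :+ con 0)) := con 1)
          ≈-refl β δ

  columnSum-1 : ∀ σ y h → let open Step σ true y in
                sumLab (newColumn σ true) h (newPart h) ≈ 1# * prodOf (zts σ) (marker (y + (β + δ)) ∘ blocked σ h)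
  columnSum-1 σ y h = begin
      sumLab W h (newPart h)
    ≈⟨ sumLab-cong W h rowwise ⟩
      sumLab W h (λ f → prodOf W (λ t → φ t (f t)))
    ≈⟨ sumLab-independent W h φ (distinct-rows tallK (suc N) (zts-distinct σ)) ⟩
      prodOf W (λ t → sumOf (allowed t) (φ t))
    ≡⟨ prodOf-map _ (zts σ) _ ⟩
      prodOf (zts σ) (λ p → sumOf (allowed (tall p)) (φ (tall p)))
    ≈⟨ prodOf-cong (zts σ) (λ p → tallSum y (blocked σ h p) p (suc N)) ⟩
      prodOf (zts σ) (marker (y + (β + δ)) ∘ blocked σ h)
    ≈⟨ *-identityˡ _ ⟨
      1# * prodOf (zts σ) (marker (y + (β + δ)) ∘ blocked σ h) ∎
    where
      open Extend σ true
      open Step σ true y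
      W = newColumn σ true
      tall : ℕ → Tile
      tall p = tile tallK p (suc N)
      φ : Tile → Lbl → Carrier
      φ t l = lw l * extendRow y (blocked σ h (rowOf t)) l
      rowwise : ∀ f → newPart h f ≈ prodOf W (λ t → φ t (f t))
      rowwise f = begin
          prodOf W (lw ∘ f) * (prodOf (zts σ) (λ p → extendRow y (blocked σ h p) (f (tall p))) * 1#)
        ≈⟨ *-congˡ (*-identityʳ _) ⟩
          prodOf W (lw ∘ f) * prodOf (zts σ) (λ p → extendRow y (blocked σ h p) (f (tall p)))
        ≡⟨ cong (_* prodOf (zts σ) (λ p → extendRow y (blocked σ h p) (f (tall p)))) (prodOf-map tall (zts σ) (lw ∘ f)) ⟩
          prodOf (zts σ) (λ p → lw (f (tall p))) * prodOf (zts σ) (λ p → extendRow y (blocked σ h p) (f (tall p)))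
        ≈⟨ prodOf-* (zts σ) _ _ ⟨
          prodOf (zts σ) (λ p → φ (tall p) (f (tall p)))
        ≡⟨ prodOf-map tall (zts σ) (λ t → φ t (f t)) ⟨
          prodOf W (λ t → φ t (f t)) ∎

  factor : ℕ → Carrier → Carrier
  factor m y = (α + γ) * y + (β + δ) + fromℕ R m * ((α + γ) * (β + δ))

  -- A new square s(p, N+1) in a row with blocked status d, below the rest of
  -- the strip (E: rest empty, S: rest summed).
  squareStep : ∀ y d E S →
    (α + γ) * y * ((lw Emp * extendRow y d Emp) * E)
      + (β + δ) * sumOf (allowed (tile sqK 0 0)) (λ l → (lw l * extendRow y d l) * (if isAC l then E else S))
    ≈ marker (y + (β + δ)) d * ((α + γ) * y * E + (β + δ) * S)
  squareStep y false E S =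
    solve 7 (λ a b g d y E S →
      (a :+ g) :* y :* ((con 1 :* (con 1 :* y)) :* E)
        :+ (b :+ d) :* ((con 1 :* (con 1 :* y)) :* S :+ ((a :* (con 1 :* y)) :* E :+ ((b :* (con 1 :* con 1)) :* S
        :+ ((g :* (con 1 :* y)) :* E :+ ((d :* (con 1 :* con 1)) :* S :+ con 0)))))
      := (y :+ (b :+ d)) :* ((a :+ g) :* y :* E :+ (b :+ d) :* S)) ≈-refl α β γ δ y E S
  squareStep y true E S =
    solve 7 (λ a b g d y E S →
      (a :+ g) :* y :* ((con 1 :* (con 1 :* con 1)) :* E)
        :+ (b :+ d) :* ((con 1 :* (con 1 :* con 1)) :* S :+ ((a :* (con 0 :* con 1)) :* E :+ ((b :* (con 0 :* con 1)) :* S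
        :+ ((g :* (con 0 :* con 1)) :* E :+ ((d :* (con 0 :* con 1)) :* S :+ con 0)))))
      := con 1 :* ((a :+ g) :* y :* E :+ (b :+ d) :* S)) ≈-refl α β γ δ y E S

  module Column02 (σ : List Bool) (y : Carrier) (h : Labelling) where
    open Extend σ false
    open NewStrip σ
    open Step σ false y

    V : List Tile
    V = newColumn σ false

    cornerWeight : Lbl → Carrier
    cornerWeight l = lw l * (ind (not (isE l)) * marker y (isBD l ∨ false))

    φ : Tile → Lbl → Carrier
    φ (tile sqK    p _) l = if p ≡ᵇ suc N then cornerWeight l else lw l * extendRow y (blocked σ h p) l
    φ (tile tallK  _ _) l = lw l
    φ (tile shortK _ _) l = lw l

    φ-corner : ∀ l → φ corner l ≡ cornerWeight l
    φ-corner l rewrite ≡ᵇ-refl (suc N) = refl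

    φ-square : ∀ {p} → p ≤ N → ∀ l → φ (tile sqK p (suc N)) l ≡ lw l * extendRow y (blocked σ h p) l
    φ-square p≤N l rewrite ≡ᵇ-false (ℕ.<⇒≢ (s≤s p≤N)) = refl

    square : ℕ → Tile
    square p = tile sqK p (suc N)

    short : ℕ → Tile
    short i = tile shortK i (suc N)

    -- The new row H_(N+1) consists of the corner alone.
    newRow : ∀ f → newRows f ≈ ind (not (isE (f corner))) * (ind (closedAfter isAC (map f V)) * marker y (isBD (f corner) ∨ false))
    newRow f = begin
        ind (conditions σ⁺ f (suc N)) * marker y (blocked σ⁺ f (suc N)) * 1#
      ≈⟨ *-identityʳ _ ⟩
        ind (conditions σ⁺ f (suc N)) * marker y (blocked σ⁺ f (suc N))
      ≡⟨ cong₂ (λ c d → ind c * marker y d) conditions-new (cong (anyB isBD ∘ map f) hstrip-new) ⟩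
        ind (not (isE (f corner)) ∧ closedAfter isAC (map f V)) * marker y (isBD (f corner) ∨ false)
      ≈⟨ trans (*-congʳ (ind-∧ (not (isE (f corner))) _)) (*-assoc _ _ _) ⟩
        ind (not (isE (f corner))) * (ind (closedAfter isAC (map f V)) * marker y (isBD (f corner) ∨ false)) ∎
      where
        conditions-new : conditions σ⁺ f (suc N) ≡ (not (isE (f corner)) ∧ closedAfter isAC (map f V))
        conditions-new = ≡.trans
          (cong (λ r → not (isE (f corner)) ∧ (closedAfter isAC (map f V) ∧ r))
                (≡.trans (cong (closedAfter isBD ∘ map f) hstrip-new) (closedAfter-single isBD (f corner))))
          (cong (not (isE (f corner)) ∧_) (∧-identityʳ _))

    squares-factor : ∀ f → prodOf squares (λ t → φ t (f t))
                           ≈ prodOf squares (lw ∘ f) * prodOf (zts σ) (λ p → extendRow y (blocked σ h p) (f (square p)))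
    squares-factor f = begin
        prodOf squares (λ t → φ t (f t))
      ≡⟨ prodOf-map square (reverse (zts σ)) _ ⟩
        prodOf (reverse (zts σ)) (λ p → φ (square p) (f (square p)))
      ≈⟨ prodOf-congAll (All.map (λ r → reflexive (φ-square (proj₂ r) _)) (All-reverse (zts-inRange σ))) ⟩
        prodOf (reverse (zts σ)) (λ p → lw (f (square p)) * extendRow y (blocked σ h p) (f (square p)))
      ≈⟨ prodOf-* (reverse (zts σ)) _ _ ⟩
        prodOf (reverse (zts σ)) (lw ∘ f ∘ square) * prodOf (reverse (zts σ)) (λ p → extendRow y (blocked σ h p) (f (square p)))
      ≈⟨ *-cong (reflexive (≡.sym (prodOf-map square (reverse (zts σ)) _))) (prodOf-reverse (zts σ) _) ⟩
        prodOf squares (lw ∘ f) * prodOf (zts σ) (λ p → extendRow y (blocked σ h p) (f (square p))) ∎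

    shorts-factor : ∀ f → prodOf shorts (λ t → φ t (f t)) ≡ prodOf shorts (lw ∘ f)
    shorts-factor f = ≡.trans (prodOf-map short (reverse (ones σ)) _) (≡.sym (prodOf-map short (reverse (ones σ)) _))

    newPart-strip : ∀ f → newPart h f ≈ ind (closedAfter isAC (map f V)) * prodOf V (λ t → φ t (f t))
    newPart-strip f = begin
        prodOf V (lw ∘ f) * (extensions * newRows f)
      ≈⟨ *-cong (reflexive (cong (λ ts → prodOf ts (lw ∘ f)) newStrip)) (*-congˡ (newRow f)) ⟩
        (lw (f corner) * prodOf (squares ++ shorts) (lw ∘ f)) * (extensions * (nonempty * (closed * mark)))
      ≈⟨ *-congʳ (*-congˡ (prodOf-++ squares shorts _)) ⟩
        (lw (f corner) * (prodOf squares (lw ∘ f) * prodOf shorts (lw ∘ f))) * (extensions * (nonempty * (closed * mark)))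
      ≈⟨ solve 7 (λ c q s e n a m → (c :* (q :* s)) :* (e :* (n :* (a :* m))) := a :* ((c :* (n :* m)) :* ((q :* e) :* s)))
                 ≈-refl (lw (f corner)) (prodOf squares (lw ∘ f)) (prodOf shorts (lw ∘ f)) extensions nonempty closed mark ⟩
        closed * (cornerWeight (f corner) * ((prodOf squares (lw ∘ f) * extensions) * prodOf shorts (lw ∘ f)))
      ≈⟨ *-congˡ (*-cong (reflexive (≡.sym (φ-corner (f corner)))) (*-cong (sym (squares-factor f)) (reflexive (≡.sym (shorts-factor f))))) ⟩
        closed * (φ corner (f corner) * (prodOf squares (λ t → φ t (f t)) * prodOf shorts (λ t → φ t (f t))))
      ≈⟨ *-congˡ (*-congˡ (prodOf-++ squares shorts _)) ⟨
        closed * prodOf (corner ∷ (squares ++ shorts)) (λ t → φ t (f t))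
      ≡⟨ cong (λ ts → closed * prodOf ts (λ t → φ t (f t))) newStrip ⟨
        closed * prodOf V (λ t → φ t (f t)) ∎
      where
        extensions = prodOf (zts σ) (λ p → extendRow y (blocked σ h p) (f (square p)))
        nonempty = ind (not (isE (f corner)))
        closed = ind (closedAfter isAC (map f V))
        mark = marker y (isBD (f corner) ∨ false)

    -- Sum over a strip X lying above a new square, split by the square's label:
    -- α or γ (the row stays free, X empty) or β or δ (the row is blocked).
    stripValue : List Tile → Carrier
    stripValue X = (α + γ) * y * prodOf X (λ t → φ t Emp) + (β + δ) * stripSum φ X

    -- The corner is nonempty, so the strip sum starts like a strip value.
    corner-step : ∀ X → stripSum φ (corner ∷ X) ≈ stripValue X
    corner-step X = begin
        sumOf (allowed corner) (λ l → φ corner l * next l)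
      ≈⟨ sumOf-cong (allowed corner) {H = λ l → cornerWeight l * next l} (λ l → *-congʳ (reflexive (φ-corner l))) ⟩
        sumOf (allowed corner) (λ l → cornerWeight l * next l)
      ≈⟨ solve 7 (λ a b g d y E S →
           (con 1 :* (con 0 :* y)) :* S :+ ((a :* (con 1 :* y)) :* E :+ ((b :* (con 1 :* con 1)) :* S
             :+ ((g :* (con 1 :* y)) :* E :+ ((d :* (con 1 :* con 1)) :* S :+ con 0))))
           := (a :+ g) :* y :* E :+ (b :+ d) :* S) ≈-refl α β γ δ y E S ⟩
        stripValue X ∎
      where
        E = prodOf X (λ t → φ t Emp)
        S = stripSum φ X
        next : Lbl → Carrier
        next l = if isAC l then E else S

    shorts-empty : ∀ is → prodOf (map short is) (λ t → φ t Emp) ≈ 1#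
    shorts-empty is = trans (reflexive (prodOf-map short is _)) (prodOf-1 is)

    -- Each short rhombus is empty, αu or γq, and everything above an α/γ is empty.
    shorts-strip : ∀ is → stripSum φ (map short is) ≈ 1# + fromℕ R (length is) * (α + γ)
    shorts-strip []       = sym (trans (+-congˡ (zeroˡ _)) (+-identityʳ _))
    shorts-strip (i ∷ is) = begin
        1# * S + (α * E + (γ * E + 0#))
      ≈⟨ +-cong (*-congˡ (shorts-strip is)) (+-cong (*-congˡ (shorts-empty is)) (+-congʳ (*-congˡ (shorts-empty is)))) ⟩
        1# * (1# + n * (α + γ)) + (α * 1# + (γ * 1# + 0#))
      ≈⟨ solve 3 (λ n a g → con 1 :* (con 1 :+ n :* (a :+ g)) :+ (a :* con 1 :+ (g :* con 1 :+ con 0))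
                            := con 1 :+ (con 1 :+ n) :* (a :+ g)) ≈-refl n α γ ⟩
        1# + (1# + n) * (α + γ) ∎
      where
        E = prodOf (map short is) (λ t → φ t Emp)
        S = stripSum φ (map short is)
        n = fromℕ R (length is)

    stripValue-shorts : stripValue shorts ≈ factor (length (ones σ)) y
    stripValue-shorts = begin
        (α + γ) * y * prodOf shorts (λ t → φ t Emp) + (β + δ) * stripSum φ shorts
      ≈⟨ +-cong (*-congˡ (shorts-empty (reverse (ones σ)))) (*-congˡ (shorts-strip (reverse (ones σ)))) ⟩
        (α + γ) * y * 1# + (β + δ) * (1# + fromℕ R (length (reverse (ones σ))) * (α + γ))
      ≡⟨ cong (λ k → (α + γ) * y * 1# + (β + δ) * (1# + fromℕ R k * (α + γ))) (List.length-reverse (ones σ)) ⟩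
        (α + γ) * y * 1# + (β + δ) * (1# + m * (α + γ))
      ≈⟨ solve 6 (λ a b g d y m → (a :+ g) :* y :* con 1 :+ (b :+ d) :* (con 1 :+ m :* (a :+ g))
                                  := (a :+ g) :* y :+ (b :+ d) :+ m :* ((a :+ g) :* (b :+ d))) ≈-refl α β γ δ y m ⟩
        factor (length (ones σ)) y ∎
      where m = fromℕ R (length (ones σ))

    stripValue-rows : ∀ ps → All (_≤ N) ps →
                      stripValue (map square ps ++ shorts) ≈ prodOf ps (marker (y + (β + δ)) ∘ blocked σ h) * factor (length (ones σ)) y
    stripValue-rows []       []         = trans stripValue-shorts (sym (*-identityˡ _))
    stripValue-rows (p ∷ ps) (p≤ ∷ ps≤) = begin
        (α + γ) * y * (φ (square p) Emp * E) + (β + δ) * sumOf (allowed (square p)) (λ l → φ (square p) l * next l)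
      ≈⟨ +-cong (*-congˡ (*-congʳ (reflexive (φ-square p≤ Emp))))
                (*-congˡ (sumOf-cong (allowed (square p)) {H = λ l → (lw l * extendRow y d l) * next l}
                                     (λ l → *-congʳ (reflexive (φ-square p≤ l))))) ⟩
        (α + γ) * y * ((lw Emp * extendRow y d Emp) * E)
          + (β + δ) * sumOf (allowed (square p)) (λ l → (lw l * extendRow y d l) * next l)
      ≈⟨ squareStep y d E S ⟩
        marker (y + (β + δ)) d * stripValue (map square ps ++ shorts)
      ≈⟨ *-congˡ (stripValue-rows ps ps≤) ⟩
        marker (y + (β + δ)) d * (prodOf ps (marker (y + (β + δ)) ∘ blocked σ h) * factor (length (ones σ)) y)
      ≈⟨ *-assoc _ _ _ ⟨
        prodOf (p ∷ ps) (marker (y + (β + δ)) ∘ blocked σ h) * factor (length (ones σ)) y ∎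
      where
        d = blocked σ h p
        E = prodOf (map square ps ++ shorts) (λ t → φ t Emp)
        S = stripSum φ (map square ps ++ shorts)
        next : Lbl → Carrier
        next l = if isAC l then E else S

    columnSum-02 : sumLab V h (newPart h) ≈ factor (length (ones σ)) y * prodOf (zts σ) (marker (y + (β + δ)) ∘ blocked σ h)
    columnSum-02 = begin
        sumLab V h (newPart h)
      ≈⟨ sumLab-cong V h newPart-strip ⟩
        sumLab V h (λ f → ind (closedAfter isAC (map f V)) * prodOf V (λ t → φ t (f t)))
      ≈⟨ sumLab-strip V h φ (≡.subst Distinct (≡.sym newStrip) newStrip-distinct) ⟩
        stripSum φ V
      ≡⟨ cong (stripSum φ) newStrip ⟩
        stripSum φ (corner ∷ (squares ++ shorts))
      ≈⟨ corner-step (squares ++ shorts) ⟩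
        stripValue (squares ++ shorts)
      ≈⟨ stripValue-rows (reverse (zts σ)) (All-reverse (All.map proj₂ (zts-inRange σ))) ⟩
        prodOf (reverse (zts σ)) (marker (y + (β + δ)) ∘ blocked σ h) * factor (length (ones σ)) y
      ≈⟨ trans (*-comm _ _) (*-congˡ (prodOf-reverse (zts σ) _)) ⟩
        factor (length (ones σ)) y * prodOf (zts σ) (marker (y + (β + δ)) ∘ blocked σ h) ∎

  productFormula : ℕ → ℕ → Carrier → Carrier
  productFormula r zero    y = 1#
  productFormula r (suc n) y = factor r y * productFormula (suc r) n y

  productFormula-shift : ∀ n r y → productFormula r n (y + (β + δ)) ≈ productFormula (suc r) n y
  productFormula-shift zero    r y = ≈-refl
  productFormula-shift (suc n) r y = *-cong
    (solve 6 (λ a b g d y k → (a :+ g) :* (y :+ (b :+ d)) :+ (b :+ d) :+ k :* ((a :+ g) :* (b :+ d))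
                              := (a :+ g) :* y :+ (b :+ d) :+ (con 1 :+ k) :* ((a :+ g) :* (b :+ d))) ≈-refl α β γ δ y (fromℕ R r))
    (productFormula-shift n (suc r) y)

  Zy-formula : ∀ σ y → Zy σ y ≈ productFormula (length (ones σ)) (length (zts σ)) y
  Zy-formula = snoc-induction (λ σ → ∀ y → Zy σ y ≈ productFormula (length (ones σ)) (length (zts σ)) y)
    (λ y → *-identityˡ 1#) step
    where
      step : ∀ σ b → (∀ y → Zy σ y ≈ productFormula (length (ones σ)) (length (zts σ)) y) →
             ∀ y → Zy (σ ++ [ b ]) y ≈ productFormula (length (ones (σ ++ [ b ]))) (length (zts (σ ++ [ b ]))) y
      step σ false ih y = begin
          Zy σ⁺ y
        ≈⟨ Step.Zy-ext σ false y _ (Column02.columnSum-02 σ y) ⟩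
          factor m y * Zy σ (y + (β + δ))
        ≈⟨ *-congˡ (trans (ih (y + (β + δ))) (productFormula-shift n m y)) ⟩
          productFormula m (suc n) y
        ≡⟨ cong₂ (λ m n → productFormula m n y) (cong length (≡.trans ones⁺ (List.++-identityʳ _)))
                                                (≡.trans (cong length zts⁺) (length-snoc (zts σ) _)) ⟨
          productFormula (length (ones σ⁺)) (length (zts σ⁺)) y ∎
        where
          open Extend σ false
          m = length (ones σ)
          n = length (zts σ)
      step σ true ih y = begin
          Zy σ⁺ y
        ≈⟨ Step.Zy-ext σ true y 1# (columnSum-1 σ y) ⟩
          1# * Zy σ (y + (β + δ))
        ≈⟨ trans (*-identityˡ _) (trans (ih (y + (β + δ))) (productFormula-shift n m y)) ⟩
          productFormula (suc m) n y
        ≡⟨ cong₂ (λ m n → productFormula m n y) (≡.trans (cong length ones⁺) (length-snoc (ones σ) _))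
                                                (cong length (≡.trans zts⁺ (List.++-identityʳ _))) ⟨
          productFormula (length (ones σ⁺)) (length (zts σ⁺)) y ∎
        where
          open Extend σ true
          m = length (ones σ)
          n = length (zts σ)

  theoremFactor : ℕ → Carrier
  theoremFactor i = α + β + γ + δ + fromℕ R i * (α + γ) * (β + δ)

  productFormula-prodRange : ∀ r N → productFormula r (N ∸ r) 1# ≈ prodRange R r N theoremFactor
  productFormula-prodRange r N = trans (atOne (N ∸ r) r) (reflexive (cong (prodL R) (≡.sym (List.map-upTo _ (N ∸ r)))))
    where
      shift : ∀ n r → applyUpTo (λ k → theoremFactor (r +ℕ suc k)) n ≡ applyUpTo (λ k → theoremFactor (suc r +ℕ k)) n
      shift n r = ≡.trans (≡.sym (List.map-upTo _ n))
                  (≡.trans (List.map-cong (λ k → cong theoremFactor (ℕ.+-suc r k)) (upTo n)) (List.map-upTo _ n))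
      atOne : ∀ n r → productFormula r n 1# ≈ prodL R (applyUpTo (λ k → theoremFactor (r +ℕ k)) n)
      atOne zero    r = ≈-refl
      atOne (suc n) r = *-cong
        (trans (solve 5 (λ a b g d k → (a :+ g) :* con 1 :+ (b :+ d) :+ k :* ((a :+ g) :* (b :+ d))
                                       := a :+ b :+ g :+ d :+ k :* (a :+ g) :* (b :+ d)) ≈-refl α β γ δ (fromℕ R r))
               (reflexive (cong theoremFactor (≡.sym (ℕ.+-identityʳ r)))))
        (trans (atOne n (suc r)) (reflexive (cong (prodL R) (≡.sym (shift n r)))))

  shapeSum : ∀ σ → sumOf (tableaux σ) (weight σ) ≈ prodRange R (length (ones σ)) (length σ) theoremFactor
  shapeSum σ = begin
      sumOf (tableaux σ) (weight σ)                            ≈⟨ tableauSum-Zy σ ⟩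
      Zy σ 1#                                                  ≈⟨ Zy-formula σ 1# ⟩
      productFormula (length (ones σ)) (length (zts σ)) 1#     ≡⟨ cong (λ n → productFormula (length (ones σ)) n 1#) (zts-length σ) ⟩
      productFormula (length (ones σ)) (length σ ∸ length (ones σ)) 1# ≈⟨ productFormula-prodRange (length (ones σ)) (length σ) ⟩
      prodRange R (length (ones σ)) (length σ) theoremFactor   ∎

  shapeSum-of-size : ∀ {σ N r} → length (ones σ) ≡ r → length σ ≡ N →
                     sumOf (tableaux σ) (weight σ) ≈ prodRange R r N theoremFactor
  shapeSum-of-size {σ} refl refl = shapeSum σ

-- Proposition 3.15.
proposition3p15 : ∀ {c ℓ : Level} (R : CommutativeSemiring c ℓ) (N r : ℕ) → r ≤ N →
    ∀ (α β γ δ : CommutativeSemiring.Carrier R) →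
    let open CommutativeSemiring R in
    Z R α β γ δ 1# 1# N r
      ≈ fromℕ R (N C r)
        * prodRange R r N (λ i → α + β + γ + δ + fromℕ R i * (α + γ) * (β + δ))
proposition3p15 R N r _ α β γ δ = begin
    sumOf (shapesOfSize R N r) (λ σ → sumOf (tableaux σ) (weight σ))
  ≈⟨ sumOf-const _ _ (shapesOfSize R N r) (All.map (λ {σ} (ones≡r , length≡N) → shapeSum-of-size {σ} ones≡r length≡N)
                                                   (shapesOfSize-sizes R N r)) ⟩
    fromℕ R (length (shapesOfSize R N r)) * prodRange R r N theoremFactor
  ≡⟨ cong (λ k → fromℕ R k * prodRange R r N theoremFactor) (shapesOfSize-count R N r) ⟩
    fromℕ R (N C r) * prodRange R r N theoremFactor ∎
  where
    open CommutativeSemiring R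
    open import Relation.Binary.Reasoning.Setoid setoid
    open BigOperators R
    open AtOne R α β γ δ
    open Weights R α β γ δ 1# 1#
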